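{- Let there be a tight derivation in system $\mathcal{V}$ of $\Gamma\vdash^{(m,e,s)} t:\sigma$. If $t\to_{dv}t'$, then there is a derivation in system $\mathcal{V}$ of $\Gamma\vdash^{(m',e',s)} t':\sigma$ such that: (1) $m'=m-1$ and $e'=e$ if $t\to_{dv}t'$ is an $m$-step; (2) $e'=e-1$ and $m'=m$ if $t\to_{dv}t'$ is an $e$-step.
   Context: Terms are $t,u,r ::= x \mid \lambda x.t \mid t\,u \mid t[x\backslash u]$ over a countably infinite set of variables, where $t[x\backslash u]$ (explicit substitution) binds $x$ in $t$; terms are taken modulo $\alpha$-conversion and $t\{x:=v\}$ is capture-avoiding meta-level substitution. Values are $v ::= x \mid \lambda x.t$. List contexts are $L ::= \square \mid L[x\backslash t]$; $L\langle t\rangle$ plugs $t$ into the hole. CBV normal forms: $\mathsf{vr}_v ::= x \mid \mathsf{vr}_v[x\backslash \mathsf{ne}_v]$; $\mathsf{ne}_v ::= \mathsf{vr}_v\,\mathsf{no}_v \mid \mathsf{ne}_v\,\mathsf{no}_v \mid \mathsf{ne}_v[x\backslash\mathsf{ne}_v]$; $\mathsf{no}_v ::= \lambda x.t \mid \mathsf{vr}_v \mid \mathsf{ne}_v \mid \mathsf{no}_v[x\backslash\mathsf{ne}_v]$. The deterministic CBV relation $\to_{dv}$ is the least relation closed under: $(L\langle\lambda x.t\rangle)\,u\to_{dv}L\langle t[x\backslash u]\rangle$ (an $m$-step); $t[x\backslash L\langle v\rangle]\to_{dv}L\langle t\{x:=v\}\rangle$ for a value $v$ (an $e$-step); if $t\to_{dv}s$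 and $t$ is not of the form $L\langle\lambda y.r\rangle$ then $t\,u\to_{dv}s\,u$; if $t\to_{dv}s$ and $u\in\mathsf{ne}_v\cup\mathsf{vr}_v$ then $u\,t\to_{dv}u\,s$; if $t\to_{dv}s$ and $t$ is not of the form $L\langle w\rangle$ for a value $w$ then $u[x\backslash t]\to_{dv}u[x\backslash s]$; if $t\to_{dv}s$ and $u\in\mathsf{ne}_v$ then $t[x\backslash u]\to_{dv}s[x\backslash u]$. A step is an $m$-step or an $e$-step according to which of the two axioms it applies at its base. Types. Tight types: $\mathtt{tt} ::= \mathtt{n} \mid \mathtt{vl} \mid \mathtt{vr}$. Types $\sigma,\tau ::= \mathtt{tt}\mid\mathcal{M}\mid\mathcal{M}\to\sigma$, with multitypes $\mathcal{M}=[\sigma_i]_{i\in I}$ finite multisets of types ($[\,]$ empty, $\sqcup$ union). Typing contexts $\Gamma$ map variables to multitypes, $[\,]$ for all but finitely many; $(\Gamma+\Delta)(x)=\Gamma(x)\sqcup\Delta(x)$, extended to finite sums; $\Gamma\setminus\!\!\setminus x$ maps $x$ to $[\,]$ and agrees with $\Gamma$ elsewhere. Judgements $\Gamma\vdash^{(m,e,s)} t:\sigma$ carry integer counters. System $\mathcal{V}$ has the rules: (var$_p$) $x:[\mathtt{vr}]\vdash^{(0,0,0)} x:\mathtt{vr}$; (val$_p$) $\emptyset\vdash^{(0,0,0)} x:\mathtt{vl}$; (abs$_p$) $\emptyset\vdash^{(0,0,0)}\lambda x.t:\mathtt{vl}$; (app$_p$) from $\Gamma\vdash^{(m,e,s)}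 t:\mathtt{tt}_1$ with $\mathtt{tt}_1\in\{\mathtt{vr},\mathtt{n}\}$ and $\Delta\vdash^{(m',e',s')} u:\mathtt{tt}_2$ with $\mathtt{tt}_2\in\{\mathtt{vl},\mathtt{n}\}$, infer $\Gamma+\Delta\vdash^{(m+m',e+e',s+s'+1)} t\,u:\mathtt{n}$; (es$_p$) from $\Gamma\vdash^{(m,e,s)} t:\tau$, $\Delta\vdash^{(m',e',s')} u:\mathtt{n}$ and $\Gamma(x)$ tight, infer $(\Gamma\setminus\!\!\setminus x)+\Delta\vdash^{(m+m',e+e',s+s')} t[x\backslash u]:\tau$; (var$_c$) $x:\mathcal{M}\vdash^{(0,1,0)} x:\mathcal{M}$ for any multitype $\mathcal{M}$; (app$_c$) from $\Gamma\vdash^{(m,e,s)} t:[\mathcal{M}\to\tau]$ and $\Delta\vdash^{(m',e',s')} u:\mathcal{M}$, infer $\Gamma+\Delta\vdash^{(m+m'+1,e+e'-1,s+s')} t\,u:\tau$; (appt$_c$) from $\Gamma\vdash^{(m,e,s)} t:[\mathcal{M}\to\tau]$, $\Delta\vdash^{(m',e',s')} u:\mathtt{n}$ and $\mathcal{M}$ tight, infer $\Gamma+\Delta\vdash^{(m+m'+1,e+e'-1,s+s')} t\,u:\tau$; (abs$_c$) from $\Gamma_i\vdash^{(m_i,e_i,s_i)} t:\tau_i$ for each $i\in I$ ($I$ finite, possibly empty), infer $+_{i\in I}(\Gamma_i\setminus\!\!\setminus x)\vdash^{(\sum_i m_i,\,1+\sum_i e_i,\,\sum_i s_i)}\lambda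 x.t:[\Gamma_i(x)\to\tau_i]_{i\in I}$; (es$_c$) from $\Gamma\vdash^{(m,e,s)} t:\sigma$ and $\Delta\vdash^{(m',e',s')} u:\Gamma(x)$, infer $(\Gamma\setminus\!\!\setminus x)+\Delta\vdash^{(m+m',e+e',s+s')} t[x\backslash u]:\sigma$. A multitype is tight if all its elements are tight types; a context is tight if all its multitypes are tight; a derivation of $\Gamma\vdash^{(m,e,s)} t:\sigma$ is tight if $\Gamma$ is tight and $\sigma$ is a tight type. -}

module Defs where

open import Data.Nat using (ℕ; zero; suc; _+_)
open import Data.Nat.Properties using (_≟_)
open import Data.Fin using (Fin)
import Data.Fin as F
open import Data.List using (List; []; _∷_; length)
import Data.List as L
open import Data.Integer using (ℤ; 0ℤ; 1ℤ) renaming (_+_ to _+ℤ_; _-_ to _-ℤ_)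
open import Data.Product using (Σ; _×_; _,_)
open import Data.Sum using (_⊎_)
open import Relation.Nullary using (¬_; yes; no)
open import Relation.Binary.PropositionalEquality using (_≡_)

-- Terms, with de Bruijn indices (terms are taken modulo α-conversion).
-- `lam t` binds index 0 in t; `es t u` is t[x\u] and binds index 0 in t
-- (but not in u).

data Tm : Set where
  var : ℕ → Tm
  lam : Tm → Tm
  app : Tm → Tm → Tm
  es  : Tm → Tm → Tm

ext : (ℕ → ℕ) → ℕ → ℕ
ext ρ zero    = zero
ext ρ (suc n) = suc (ρ n)

rename : (ℕ → ℕ) → Tm → Tm
rename ρ (var x)   = var (ρ x)
rename ρ (lam t)   = lam (rename (ext ρ) t)
rename ρ (app t u) = app (rename ρ t) (rename ρ u)
rename ρ (es t u)  = es (rename (ext ρ) t) (rename ρ u)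

exts : (ℕ → Tm) → ℕ → Tm
exts σ zero    = var zero
exts σ (suc n) = rename suc (σ n)

subst : (ℕ → Tm) → Tm → Tm
subst σ (var x)   = σ x
subst σ (lam t)   = lam (subst (exts σ) t)
subst σ (app t u) = app (subst σ t) (subst σ u)
subst σ (es t u)  = es (subst (exts σ) t) (subst σ u)

-- t{x:=v} where x is index 0 of t (capture-avoiding, decrements the rest)
subst0 : Tm → Tm → Tm
subst0 v t = subst σ t
  where
  σ : ℕ → Tm
  σ zero    = v
  σ (suc n) = var n

shift : ℕ → Tm → Tm
shift k = rename (k +_)

data Value : Tm → Set where
  var : ∀ x → Value (var x)
  lam : ∀ t → Value (lam t)

-- List contexts  L ::= □ | L[x\t].  The list head is the outermost
-- substitution: plug (u ∷ L) s = (plug L s)[x\u].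

LCtx : Set
LCtx = List Tm

plug : LCtx → Tm → Tm
plug []      s = s
plug (u ∷ L) s = es (plug L s) u

IsLAbs : Tm → Set
IsLAbs t = Σ LCtx λ L → Σ Tm λ r → t ≡ plug L (lam r)

IsLVal : Tm → Set
IsLVal t = Σ LCtx λ L → Σ Tm λ w → Value w × (t ≡ plug L w)

mutual
  data VR : Tm → Set where
    var : ∀ x → VR (var x)
    es  : ∀ {t u} → VR t → NE u → VR (es t u)

  data NE : Tm → Set where
    appVR : ∀ {t u} → VR t → NO u → NE (app t u)
    appNE : ∀ {t u} → NE t → NO u → NE (app t u)
    es    : ∀ {t u} → NE t → NE u → NE (es t u)

  data NO : Tm → Set where
    lam : ∀ t → NO (lam t)
    vr  : ∀ {t} → VR t → NO t
    ne  : ∀ {t} → NE t → NO t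
    es  : ∀ {t u} → NO t → NE u → NO (es t u)

data Kind : Set where
  m-step e-step : Kind

data _⟶[_]_ : Tm → Kind → Tm → Set where
  dB   : ∀ L t u →
         app (plug L (lam t)) u ⟶[ m-step ] plug L (es t (shift (length L) u))
  sv   : ∀ L t v → Value v →
         es t (plug L v) ⟶[ e-step ]
           plug L (subst0 v (rename (ext (length L +_)) t))
  appL : ∀ {k t s} u → t ⟶[ k ] s → ¬ IsLAbs t → app t u ⟶[ k ] app s u
  appR : ∀ {k t s u} → NE u ⊎ VR u → t ⟶[ k ] s → app u t ⟶[ k ] app u s
  esR  : ∀ {k t s} u → t ⟶[ k ] s → ¬ IsLVal t → es u t ⟶[ k ] es u s
  esL  : ∀ {k t s u} → t ⟶[ k ] s → NE u → es t u ⟶[ k ] es s u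

-- Types.  Multitypes (finite multisets) are represented by lists,
-- identified up to the equivalence _≈M_ (permutation, recursively up to
-- equivalence of the element types).

data Ty : Set where
  n vl vr : Ty
  mul     : List Ty → Ty
  _⇒_     : List Ty → Ty → Ty

MTy : Set
MTy = List Ty

mutual
  data _≈T_ : Ty → Ty → Set where
    n   : n ≈T n
    vl  : vl ≈T vl
    vr  : vr ≈T vr
    mul : ∀ {M N} → M ≈M N → mul M ≈T mul N
    arr : ∀ {M N σ τ} → M ≈M N → σ ≈T τ → (M ⇒ σ) ≈T (N ⇒ τ)

  data _≈M_ : MTy → MTy → Set where
    []    : [] ≈M []
    _∷_   : ∀ {σ τ M N} → σ ≈T τ → M ≈M N → (σ ∷ M) ≈M (τ ∷ N)
    swap  : ∀ σ τ M → (σ ∷ τ ∷ M) ≈M (τ ∷ σ ∷ M)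
    trans : ∀ {M N P} → M ≈M N → N ≈M P → M ≈M P

data TightTy : Ty → Set where
  n  : TightTy n
  vl : TightTy vl
  vr : TightTy vr

data TightMT : MTy → Set where
  []  : TightMT []
  _∷_ : ∀ {σ M} → TightTy σ → TightMT M → TightMT (σ ∷ M)

Ctx : Set
Ctx = ℕ → MTy

∅ : Ctx
∅ _ = []

_⊕_ : Ctx → Ctx → Ctx
(Γ ⊕ Δ) x = Γ x L.++ Δ x

single : ℕ → MTy → Ctx
single x M y with y ≟ x
... | yes _ = M
... | no  _ = []

-- (Γ \\ x) for the bound variable x = index 0, read in the outer scope
pop : Ctx → Ctx
pop Γ y = Γ (suc y)

TightCtx : Ctx → Set
TightCtx Γ = ∀ x → TightMT (Γ x)

_≈C_ : Ctx → Ctx → Set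
Γ ≈C Δ = ∀ x → Γ x ≈M Δ x

sumℤ : ∀ {k} → (Fin k → ℤ) → ℤ
sumℤ {zero}  f = 0ℤ
sumℤ {suc k} f = f F.zero +ℤ sumℤ (λ i → f (F.suc i))

sumCtx : ∀ {k} → (Fin k → Ctx) → Ctx
sumCtx {zero}  f = ∅
sumCtx {suc k} f = f F.zero ⊕ sumCtx (λ i → f (F.suc i))

data _⊢[_,_,_]_∶_ : Ctx → ℤ → ℤ → ℤ → Tm → Ty → Set where
  var-p : ∀ x → single x (vr ∷ []) ⊢[ 0ℤ , 0ℤ , 0ℤ ] var x ∶ vr
  val-p : ∀ x → ∅ ⊢[ 0ℤ , 0ℤ , 0ℤ ] var x ∶ vl
  abs-p : ∀ t → ∅ ⊢[ 0ℤ , 0ℤ , 0ℤ ] lam t ∶ vl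
  app-p : ∀ {Γ Δ m e s m' e' s' t u tt₁ tt₂} →
          Γ ⊢[ m , e , s ] t ∶ tt₁ → (tt₁ ≡ vr ⊎ tt₁ ≡ n) →
          Δ ⊢[ m' , e' , s' ] u ∶ tt₂ → (tt₂ ≡ vl ⊎ tt₂ ≡ n) →
          (Γ ⊕ Δ) ⊢[ m +ℤ m' , e +ℤ e' , (s +ℤ s') +ℤ 1ℤ ] app t u ∶ n
  es-p  : ∀ {Γ Δ m e s m' e' s' t u τ} →
          Γ ⊢[ m , e , s ] t ∶ τ →
          Δ ⊢[ m' , e' , s' ] u ∶ n →
          TightMT (Γ zero) →
          (pop Γ ⊕ Δ) ⊢[ m +ℤ m' , e +ℤ e' , s +ℤ s' ] es t u ∶ τ
  var-c : ∀ x M → single x M ⊢[ 0ℤ , 1ℤ , 0ℤ ] var x ∶ mul M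
  app-c : ∀ {Γ Δ m e s m' e' s' t u M M' τ} →
          Γ ⊢[ m , e , s ] t ∶ mul ((M ⇒ τ) ∷ []) →
          Δ ⊢[ m' , e' , s' ] u ∶ mul M' → M' ≈M M →
          (Γ ⊕ Δ) ⊢[ (m +ℤ m') +ℤ 1ℤ , (e +ℤ e') -ℤ 1ℤ , s +ℤ s' ] app t u ∶ τ
  appt-c : ∀ {Γ Δ m e s m' e' s' t u M τ} →
          Γ ⊢[ m , e , s ] t ∶ mul ((M ⇒ τ) ∷ []) →
          Δ ⊢[ m' , e' , s' ] u ∶ n → TightMT M →
          (Γ ⊕ Δ) ⊢[ (m +ℤ m') +ℤ 1ℤ , (e +ℤ e') -ℤ 1ℤ , s +ℤ s' ] app t u ∶ τ
  abs-c : ∀ {k t} (Γs : Fin k → Ctx) (ms es ss : Fin k → ℤ) (τs : Fin k → Ty) →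
          ((i : Fin k) → Γs i ⊢[ ms i , es i , ss i ] t ∶ τs i) →
          sumCtx (λ i → pop (Γs i))
            ⊢[ sumℤ ms , 1ℤ +ℤ sumℤ es , sumℤ ss ]
            lam t ∶ mul (L.tabulate (λ i → Γs i zero ⇒ τs i))
  es-c  : ∀ {Γ Δ m e s m' e' s' t u σ M} →
          Γ ⊢[ m , e , s ] t ∶ σ →
          Δ ⊢[ m' , e' , s' ] u ∶ mul M → M ≈M Γ zero →
          (pop Γ ⊕ Δ) ⊢[ m +ℤ m' , e +ℤ e' , s +ℤ s' ] es t u ∶ σ

CounterSpec : Kind → ℤ → ℤ → ℤ → ℤ → Set
CounterSpec m-step m e m' e' = (m' ≡ m -ℤ 1ℤ) × (e' ≡ e)
CounterSpec e-step m e m' e' = (e' ≡ e -ℤ 1ℤ) × (m' ≡ m)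

-- An m-step (λx.t)u ⟶ t[x\u] replaces an app-c node, which counts one m and
-- minus one e, by an es-c node, while the abs-c node of λx.t that disappears
-- counted one e: so m drops by one and e is unchanged.  An e-step
-- t[x\v] ⟶ t{x:=v} rests on the substitution lemma: the multitype of v is the
-- union of the multitypes of the occurrences of x, so the derivation of v
-- splits into one piece per occurrence, with contexts and counters adding up.
-- Each var-c occurrence of x, counting one e, is replaced by its piece, whose
-- root counts one e as well; only the root of the derivation of v is lost, so
-- e drops by one.  Tightness of the context excludes the cases where the
-- strategy reduces beside a normal form: in a tight context a neutral term has
-- type n and no variable-like normal form has an arrow type, so the typing
-- rules these cases would need cannot have been used.  Contexts and types are
-- preserved up to permutation of multitypes.

module Submission where

open import Defs
open import Data.Integer using (ℤ)
open import Data.Product using (Σ; _×_)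

open import Level using (0ℓ)
open import Function using (_∘_)
open import Data.Empty using (⊥-elim)
open import Data.Sum using (_⊎_; inj₁; inj₂)
open import Data.Product using (_,_; proj₁; proj₂)
open import Relation.Nullary using (¬_; yes; no)
open import Relation.Binary.PropositionalEquality as Eq using (_≡_; refl)
import Relation.Binary.Reasoning.Setoid as SetoidReasoning
open import Algebra.Bundles using (CommutativeMonoid)
import Algebra.Construct.Pointwise as Power
open import Data.Nat using (ℕ; zero; suc; _+_)
open import Data.Nat.Properties using (_≟_)
open import Data.Integer using (0ℤ; 1ℤ) renaming (_+_ to _+ℤ_; _-_ to _-ℤ_; -_ to -ℤ_)
open import Data.Integer.Properties
  using (+-0-commutativeMonoid; +-commutativeSemigroup; +-identityˡ; +-identityʳ; +-assoc)
open import Algebra.Properties.CommutativeSemigroup +-commutativeSemigroup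
  using () renaming (interchange to ℤ-interchange; xy∙z≈xz∙y to ℤ-xy∙z≈xz∙y)
open import Data.Integer.Tactic.RingSolver using (solve-∀)
open import Data.Fin using (Fin)
import Data.Fin as F
import Data.Vec.Functional as V
open import Data.List using (List; []; _∷_; _++_; tabulate; map; foldr; lookup; length)
open import Data.List.Properties using (++-assoc; ++-identityʳ; map-tabulate; tabulate-lookup)
open import Data.List.Relation.Binary.Pointwise using (Pointwise; []; _∷_)
import Data.List.Relation.Binary.Pointwise as Pointwise
open import Data.List.Relation.Binary.Permutation.Propositional using (_↭_; ↭⇒↭ₛ′)
import Data.List.Relation.Binary.Permutation.Propositional as Perm
import Data.List.Relation.Binary.Permutation.Propositional.Properties as ↭

mutual
  ≈T-refl : ∀ σ → σ ≈T σ
  ≈T-refl n       = n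
  ≈T-refl vl      = vl
  ≈T-refl vr      = vr
  ≈T-refl (mul M) = mul (≈M-refl M)
  ≈T-refl (M ⇒ σ) = arr (≈M-refl M) (≈T-refl σ)

  ≈M-refl : ∀ M → M ≈M M
  ≈M-refl []      = []
  ≈M-refl (σ ∷ M) = ≈T-refl σ ∷ ≈M-refl M

mutual
  ≈T-sym : ∀ {σ τ} → σ ≈T τ → τ ≈T σ
  ≈T-sym n         = n
  ≈T-sym vl        = vl
  ≈T-sym vr        = vr
  ≈T-sym (mul p)   = mul (≈M-sym p)
  ≈T-sym (arr p q) = arr (≈M-sym p) (≈T-sym q)

  ≈M-sym : ∀ {M N} → M ≈M N → N ≈M M
  ≈M-sym []          = []
  ≈M-sym (p ∷ q)     = ≈T-sym p ∷ ≈M-sym q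
  ≈M-sym (swap σ τ M) = swap τ σ M
  ≈M-sym (trans p q) = trans (≈M-sym q) (≈M-sym p)

≈T-trans : ∀ {σ τ ρ} → σ ≈T τ → τ ≈T ρ → σ ≈T ρ
≈T-trans n         n           = n
≈T-trans vl        vl          = vl
≈T-trans vr        vr          = vr
≈T-trans (mul p)   (mul q)     = mul (trans p q)
≈T-trans (arr p q) (arr p′ q′) = arr (trans p p′) (≈T-trans q q′)

≈M-reflexive : ∀ {M N} → M ≡ N → M ≈M N
≈M-reflexive {M} refl = ≈M-refl M

++-congʳ-≈M : ∀ {M M′} → M ≈M M′ → ∀ N → (M ++ N) ≈M (M′ ++ N)
++-congʳ-≈M []           N = ≈M-refl N
++-congʳ-≈M (p ∷ q)      N = p ∷ ++-congʳ-≈M q N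
++-congʳ-≈M (swap σ τ M) N = swap σ τ (M ++ N)
++-congʳ-≈M (trans p q)  N = trans (++-congʳ-≈M p N) (++-congʳ-≈M q N)

++-congˡ-≈M : ∀ M {N N′} → N ≈M N′ → (M ++ N) ≈M (M ++ N′)
++-congˡ-≈M []      q = q
++-congˡ-≈M (σ ∷ M) q = ≈T-refl σ ∷ ++-congˡ-≈M M q

++-cong-≈M : ∀ {M M′ N N′} → M ≈M M′ → N ≈M N′ → (M ++ N) ≈M (M′ ++ N′)
++-cong-≈M {M′ = M′} {N} p q = trans (++-congʳ-≈M p N) (++-congˡ-≈M M′ q)

∷-++-≈M : ∀ σ M N → (σ ∷ M ++ N) ≈M (M ++ σ ∷ N)
∷-++-≈M σ []      N = ≈M-refl (σ ∷ N)
∷-++-≈M σ (τ ∷ M) N = trans (swap σ τ (M ++ N)) (≈T-refl τ ∷ ∷-++-≈M σ M N)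

++-comm-≈M : ∀ M N → (M ++ N) ≈M (N ++ M)
++-comm-≈M []      N = ≈M-reflexive (Eq.sym (++-identityʳ N))
++-comm-≈M (σ ∷ M) N = trans (≈T-refl σ ∷ ++-comm-≈M M N) (∷-++-≈M σ N M)

multitypes : CommutativeMonoid 0ℓ 0ℓ
multitypes = record
  { Carrier = MTy
  ; _≈_     = _≈M_
  ; _∙_     = _++_
  ; ε       = []
  ; isCommutativeMonoid = record
    { isMonoid = record
      { isSemigroup = record
        { isMagma = record
          { isEquivalence = record { refl = ≈M-refl _ ; sym = ≈M-sym ; trans = trans }
          ; ∙-cong        = ++-cong-≈M
          }
        ; assoc = λ M N P → ≈M-reflexive (++-assoc M N P)
        }
      ; identity = ≈M-refl , λ M → ≈M-reflexive (++-identityʳ M)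
      }
    ; comm = ++-comm-≈M
    }
  }

contexts : CommutativeMonoid 0ℓ 0ℓ
contexts = Power.commutativeMonoid ℕ multitypes

open CommutativeMonoid contexts using ()
  renaming ( refl to ≈C-refl; sym to ≈C-sym; trans to ≈C-trans; setoid to ctx-setoid
           ; ∙-cong to ⊕-cong; ∙-congˡ to ⊕-congˡ; ∙-congʳ to ⊕-congʳ
           ; comm to ⊕-comm; identityʳ to ⊕-identityʳ )
open import Algebra.Properties.CommutativeSemigroup (CommutativeMonoid.commutativeSemigroup contexts)
  using () renaming (interchange to ⊕-interchange; xy∙z≈xz∙y to ⊕-xy∙z≈xz∙y)

≈C-reflexive : ∀ {Γ Δ} → (∀ x → Γ x ≡ Δ x) → Γ ≈C Δ
≈C-reflexive p x = ≈M-reflexive (p x)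

TightTy-resp-≈T : ∀ {σ τ} → σ ≈T τ → TightTy σ → TightTy τ
TightTy-resp-≈T n  n  = n
TightTy-resp-≈T vl vl = vl
TightTy-resp-≈T vr vr = vr

TightMT-resp-≈M : ∀ {M N} → M ≈M N → TightMT M → TightMT N
TightMT-resp-≈M []           tM          = tM
TightMT-resp-≈M (p ∷ q)      (tσ ∷ tM)   = TightTy-resp-≈T p tσ ∷ TightMT-resp-≈M q tM
TightMT-resp-≈M (swap σ τ M) (tσ ∷ tτ ∷ tM) = tτ ∷ tσ ∷ tM
TightMT-resp-≈M (trans p q)  tM          = TightMT-resp-≈M q (TightMT-resp-≈M p tM)

TightMT-++⁻ˡ : ∀ M {N} → TightMT (M ++ N) → TightMT M
TightMT-++⁻ˡ []      _         = []
TightMT-++⁻ˡ (σ ∷ M) (tσ ∷ tM) = tσ ∷ TightMT-++⁻ˡ M tM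

TightMT-++⁻ʳ : ∀ M {N} → TightMT (M ++ N) → TightMT N
TightMT-++⁻ʳ []      tN        = tN
TightMT-++⁻ʳ (σ ∷ M) (_ ∷ tMN) = TightMT-++⁻ʳ M tMN

≈T-tight⇒≡ : ∀ {σ τ} → σ ≈T τ → TightTy τ → σ ≡ τ
≈T-tight⇒≡ n  n  = refl
≈T-tight⇒≡ vl vl = refl
≈T-tight⇒≡ vr vr = refl

TightCtx-⊕⁻ˡ : ∀ {Γ Δ} → TightCtx (Γ ⊕ Δ) → TightCtx Γ
TightCtx-⊕⁻ˡ {Γ} tΓΔ x = TightMT-++⁻ˡ (Γ x) (tΓΔ x)

TightCtx-⊕⁻ʳ : ∀ {Γ Δ} → TightCtx (Γ ⊕ Δ) → TightCtx Δ
TightCtx-⊕⁻ʳ {Γ} tΓΔ x = TightMT-++⁻ʳ (Γ x) (tΓΔ x)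

TightCtx-unpop : ∀ {Γ} → TightMT (Γ zero) → TightCtx (pop Γ) → TightCtx Γ
TightCtx-unpop t₀ _  zero    = t₀
TightCtx-unpop _  tΓ (suc x) = tΓ x

≈M-[]⁻ : ∀ {M} → M ≈M [] → M ≡ []
≈M-[]⁻ p = go (≈M-sym p) refl
  where
  go : ∀ {M N} → M ≈M N → M ≡ [] → N ≡ []
  go []          _  = refl
  go (trans p q) eq = go q (go p eq)

≈M-[-]⁻ : ∀ {σ N} → (σ ∷ []) ≈M N → Σ Ty λ τ → (N ≡ τ ∷ []) × (σ ≈T τ)
≈M-[-]⁻ p = go p refl
  where
  go : ∀ {M N σ} → M ≈M N → M ≡ σ ∷ [] → Σ Ty λ τ → (N ≡ τ ∷ []) × (σ ≈T τ)
  go (p ∷ q) refl with ≈M-[]⁻ (≈M-sym q)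
  ... | refl = _ , refl , p
  go (trans p q) eq with go p eq
  ... | _ , eq′ , r with go q eq′
  ... | τ , eq″ , r′ = τ , eq″ , ≈T-trans r r′

≈T-mul⁻ : ∀ {σ M} → σ ≈T mul M → Σ MTy λ N → (σ ≡ mul N) × (N ≈M M)
≈T-mul⁻ (mul p) = _ , refl , p

≈T-arrow⁻ : ∀ {σ M τ} → σ ≈T mul ((M ⇒ τ) ∷ []) →
  Σ MTy λ N → Σ Ty λ ρ → (σ ≡ mul ((N ⇒ ρ) ∷ [])) × (N ≈M M) × (ρ ≈T τ)
≈T-arrow⁻ (mul p) with ≈M-[-]⁻ (≈M-sym p)
... | _ , refl , arr q r = _ , _ , refl , ≈M-sym q , ≈T-sym r

vr⊎n-resp-≈T : ∀ {σ′ σ} → σ′ ≈T σ → σ ≡ vr ⊎ σ ≡ n → σ′ ≡ vr ⊎ σ′ ≡ n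
vr⊎n-resp-≈T vr (inj₁ refl) = inj₁ refl
vr⊎n-resp-≈T n  (inj₂ refl) = inj₂ refl

vl⊎n-resp-≈T : ∀ {σ′ σ} → σ′ ≈T σ → σ ≡ vl ⊎ σ ≡ n → σ′ ≡ vl ⊎ σ′ ≡ n
vl⊎n-resp-≈T vl (inj₁ refl) = inj₁ refl
vl⊎n-resp-≈T n  (inj₂ refl) = inj₂ refl

-- `single` by structural recursion, matching the recursion of the context operations below.
single′ : ℕ → MTy → Ctx
single′ zero    M zero    = M
single′ zero    M (suc y) = []
single′ (suc x) M zero    = []
single′ (suc x) M (suc y) = single′ x M y

single′-self : ∀ x M → single′ x M x ≡ M
single′-self zero    M = refl
single′-self (suc x) M = single′-self x M

single≡single′ : ∀ x M y → single x M y ≡ single′ x M y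
single≡single′ x M y with y ≟ x
... | yes refl = Eq.sym (single′-self y M)
... | no y≢x   = elsewhere x y y≢x
  where
  elsewhere : ∀ x y → ¬ y ≡ x → [] ≡ single′ x M y
  elsewhere zero    zero    y≢x = ⊥-elim (y≢x refl)
  elsewhere zero    (suc y) _   = refl
  elsewhere (suc x) zero    _   = refl
  elsewhere (suc x) (suc y) y≢x = elsewhere x y (λ eq → y≢x (Eq.cong suc eq))

single≈single′ : ∀ x M → single x M ≈C single′ x M
single≈single′ x M = ≈C-reflexive (single≡single′ x M)

single-self : ∀ x M → single x M x ≡ M
single-self x M = Eq.trans (single≡single′ x M x) (single′-self x M)

single′-++ : ∀ x A B y → single′ x (A ++ B) y ≡ (single′ x A ⊕ single′ x B) y
single′-++ zero    A B zero    = refl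
single′-++ zero    A B (suc y) = refl
single′-++ (suc x) A B zero    = refl
single′-++ (suc x) A B (suc y) = single′-++ x A B y

single′-[] : ∀ x y → single′ x [] y ≡ []
single′-[] zero    zero    = refl
single′-[] zero    (suc y) = refl
single′-[] (suc x) zero    = refl
single′-[] (suc x) (suc y) = single′-[] x y

single′-cong : ∀ x {A B} → A ≈M B → single′ x A ≈C single′ x B
single′-cong zero    p zero    = p
single′-cong zero    p (suc y) = []
single′-cong (suc x) p zero    = []
single′-cong (suc x) p (suc y) = single′-cong x p y

single-cong : ∀ x {A B} → A ≈M B → single x A ≈C single x B
single-cong x {A} {B} p = begin
  single x A   ≈⟨ single≈single′ x A ⟩
  single′ x A  ≈⟨ single′-cong x p ⟩
  single′ x B  ≈⟨ single≈single′ x B ⟨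
  single x B   ∎
  where open SetoidReasoning ctx-setoid

single-⊕ : ∀ x A B → (single x A ⊕ single x B) ≈C single x (A ++ B)
single-⊕ x A B = begin
  single x A ⊕ single x B    ≈⟨ ⊕-cong (single≈single′ x A) (single≈single′ x B) ⟩
  single′ x A ⊕ single′ x B  ≈⟨ ≈C-reflexive (single′-++ x A B) ⟨
  single′ x (A ++ B)         ≈⟨ single≈single′ x (A ++ B) ⟨
  single x (A ++ B)          ∎
  where open SetoidReasoning ctx-setoid

single-[] : ∀ x → single x [] ≈C ∅
single-[] x y = ≈M-reflexive (Eq.trans (single≡single′ x [] y) (single′-[] x y))

sumCtx-cong : ∀ {k} {f g : Fin k → Ctx} → (∀ i → f i ≈C g i) → sumCtx f ≈C sumCtx g
sumCtx-cong {zero}  p = ≈C-refl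
sumCtx-cong {suc k} p = ⊕-cong (p F.zero) (sumCtx-cong (p ∘ F.suc))

sumCtx-⊕ : ∀ {k} (f g : Fin k → Ctx) → sumCtx (λ i → f i ⊕ g i) ≈C (sumCtx f ⊕ sumCtx g)
sumCtx-⊕ {zero}  f g = ≈C-sym (⊕-identityʳ ∅)
sumCtx-⊕ {suc k} f g = ≈C-trans (⊕-congˡ (sumCtx-⊕ (f ∘ F.suc) (g ∘ F.suc)))
                                (⊕-interchange (f F.zero) (g F.zero) _ _)

concatMT : ∀ {k} → (Fin k → MTy) → MTy
concatMT {zero}  f = []
concatMT {suc k} f = f F.zero ++ concatMT (f ∘ F.suc)

sumCtx-at : ∀ {k} (f : Fin k → Ctx) y → sumCtx f y ≡ concatMT (λ i → f i y)
sumCtx-at {zero}  f y = refl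
sumCtx-at {suc k} f y = Eq.cong (f F.zero y ++_) (sumCtx-at (f ∘ F.suc) y)

record _⊢≈[_,_,_]_∶_ (Γ : Ctx) (m e s : ℤ) (t : Tm) (σ : Ty) : Set where
  constructor typed
  field
    {ctx} : Ctx
    {ty}  : Ty
    deriv : ctx ⊢[ m , e , s ] t ∶ ty
    ctx≈  : ctx ≈C Γ
    ty≈   : ty ≈T σ
open _⊢≈[_,_,_]_∶_

recount : ∀ {Γ m e s m′ e′ s′ t σ} → Γ ⊢[ m , e , s ] t ∶ σ →
          m ≡ m′ → e ≡ e′ → s ≡ s′ → Γ ⊢[ m′ , e′ , s′ ] t ∶ σ
recount d refl refl refl = d

cast-term : ∀ {Γ m e s t t′ σ} → t ≡ t′ → Γ ⊢[ m , e , s ] t ∶ σ → Γ ⊢[ m , e , s ] t′ ∶ σ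
cast-term refl d = d

cast-type : ∀ {Γ m e s t σ σ′} → σ ≡ σ′ → Γ ⊢[ m , e , s ] t ∶ σ → Γ ⊢[ m , e , s ] t ∶ σ′
cast-type refl d = d

tabulate-≈M : ∀ {k} {f g : Fin k → Ty} → (∀ i → f i ≈T g i) → tabulate f ≈M tabulate g
tabulate-≈M {zero}  p = []
tabulate-≈M {suc k} p = p F.zero ∷ tabulate-≈M (p ∘ F.suc)

≈-conv : ∀ {Γ Γ′ m e s t t′ σ} → Γ ≈C Γ′ → t ≡ t′ →
         Γ ⊢≈[ m , e , s ] t ∶ σ → Γ′ ⊢≈[ m , e , s ] t′ ∶ σ
≈-conv c refl (typed d c′ q) = typed d (≈C-trans c′ c) q

-- Weakening

wk : ℕ → ℕ → ℕ → ℕ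
wk zero    k = k +_
wk (suc j) k = ext (wk j k)

-- `wkCtx j k Γ` is the context of a term renamed by `wk j k`: k empty
-- slots are inserted at position j.
wkCtx : ℕ → ℕ → Ctx → Ctx
wkCtx zero    zero    Γ y       = Γ y
wkCtx zero    (suc k) Γ zero    = []
wkCtx zero    (suc k) Γ (suc y) = wkCtx zero k Γ y
wkCtx (suc j) k       Γ zero    = Γ zero
wkCtx (suc j) k       Γ (suc y) = wkCtx j k (pop Γ) y

wkCtx-⊕ : ∀ j k Γ Δ y → wkCtx j k (Γ ⊕ Δ) y ≡ (wkCtx j k Γ ⊕ wkCtx j k Δ) y
wkCtx-⊕ zero    zero    Γ Δ y       = refl
wkCtx-⊕ zero    (suc k) Γ Δ zero    = refl
wkCtx-⊕ zero    (suc k) Γ Δ (suc y) = wkCtx-⊕ zero k Γ Δ y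
wkCtx-⊕ (suc j) k       Γ Δ zero    = refl
wkCtx-⊕ (suc j) k       Γ Δ (suc y) = wkCtx-⊕ j k (pop Γ) (pop Δ) y

wkCtx-∅ : ∀ j k y → wkCtx j k ∅ y ≡ []
wkCtx-∅ zero    zero    y       = refl
wkCtx-∅ zero    (suc k) zero    = refl
wkCtx-∅ zero    (suc k) (suc y) = wkCtx-∅ zero k y
wkCtx-∅ (suc j) k       zero    = refl
wkCtx-∅ (suc j) k       (suc y) = wkCtx-∅ j k y

wkCtx-single′ : ∀ j k x M y → wkCtx j k (single′ x M) y ≡ single′ (wk j k x) M y
wkCtx-single′ zero    zero    x       M y       = refl
wkCtx-single′ zero    (suc k) x       M zero    = refl
wkCtx-single′ zero    (suc k) x       M (suc y) = wkCtx-single′ zero k x M y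
wkCtx-single′ (suc j) k       zero    M zero    = refl
wkCtx-single′ (suc j) k       zero    M (suc y) = wkCtx-∅ j k y
wkCtx-single′ (suc j) k       (suc x) M zero    = refl
wkCtx-single′ (suc j) k       (suc x) M (suc y) = wkCtx-single′ j k x M y

wkCtx-cong : ∀ j k {Γ Δ} → Γ ≈C Δ → wkCtx j k Γ ≈C wkCtx j k Δ
wkCtx-cong zero    zero    p y       = p y
wkCtx-cong zero    (suc k) p zero    = []
wkCtx-cong zero    (suc k) p (suc y) = wkCtx-cong zero k p y
wkCtx-cong (suc j) k       p zero    = p zero
wkCtx-cong (suc j) k       p (suc y) = wkCtx-cong j k (λ x → p (suc x)) y

wkCtx-suc : ∀ k Γ y → wkCtx zero (suc k) Γ y ≡ wkCtx zero k (wkCtx zero 1 Γ) y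
wkCtx-suc zero    Γ y       = refl
wkCtx-suc (suc k) Γ zero    = refl
wkCtx-suc (suc k) Γ (suc y) = wkCtx-suc k Γ y

wk-∅ : ∀ j k → ∅ ≈C wkCtx j k ∅
wk-∅ j k y = ≈M-reflexive (Eq.sym (wkCtx-∅ j k y))

wkCtx-sumCtx : ∀ j k {K} (f : Fin K → Ctx) → sumCtx (wkCtx j k ∘ f) ≈C wkCtx j k (sumCtx f)
wkCtx-sumCtx j k {zero}  f = wk-∅ j k
wkCtx-sumCtx j k {suc K} f y =
  trans (++-congˡ-≈M (wkCtx j k (f F.zero) y) (wkCtx-sumCtx j k (f ∘ F.suc) y))
        (≈M-reflexive (Eq.sym (wkCtx-⊕ j k (f F.zero) (sumCtx (f ∘ F.suc)) y)))

wk-single : ∀ j k x M → single (wk j k x) M ≈C wkCtx j k (single x M)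
wk-single j k x M = begin
  single (wk j k x) M         ≈⟨ single≈single′ (wk j k x) M ⟩
  single′ (wk j k x) M        ≈⟨ ≈C-reflexive (wkCtx-single′ j k x M) ⟨
  wkCtx j k (single′ x M)     ≈⟨ wkCtx-cong j k (single≈single′ x M) ⟨
  wkCtx j k (single x M)      ∎
  where open SetoidReasoning ctx-setoid

wk-⊕ : ∀ j k {Γ Δ Γ′ Δ′} → Γ′ ≈C wkCtx j k Γ → Δ′ ≈C wkCtx j k Δ →
       (Γ′ ⊕ Δ′) ≈C wkCtx j k (Γ ⊕ Δ)
wk-⊕ j k {Γ} {Δ} p q = ≈C-trans (⊕-cong p q) (≈C-reflexive (Eq.sym ∘ wkCtx-⊕ j k Γ Δ))

weaken : ∀ {Γ m e s t σ} → Γ ⊢[ m , e , s ] t ∶ σ →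
         ∀ j k → wkCtx j k Γ ⊢≈[ m , e , s ] rename (wk j k) t ∶ σ
weaken (var-p x)   j k = typed (var-p _) (wk-single j k x _) vr
weaken (val-p x)   j k = typed (val-p _) (wk-∅ j k) vl
weaken (abs-p t)   j k = typed (abs-p _) (wk-∅ j k) vl
weaken (var-c x M) j k = typed (var-c _ M) (wk-single j k x M) (≈T-refl _)
weaken (app-p d p d′ q) j k with weaken d j k | weaken d′ j k
... | typed d₁ c₁ q₁ | typed d₂ c₂ q₂ =
  typed (app-p d₁ (vr⊎n-resp-≈T q₁ p) d₂ (vl⊎n-resp-≈T q₂ q)) (wk-⊕ j k c₁ c₂) n
weaken (es-p d d′ tM) j k with weaken d (suc j) k | weaken d′ j k
... | typed d₁ c₁ q₁ | typed d₂ c₂ q₂ =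
  typed (es-p d₁ (cast-type (≈T-tight⇒≡ q₂ n) d₂) (TightMT-resp-≈M (≈M-sym (c₁ zero)) tM))
        (wk-⊕ j k (c₁ ∘ suc) c₂) q₁
weaken (es-c d d′ p) j k with weaken d (suc j) k | weaken d′ j k
... | typed d₁ c₁ q₁ | typed d₂ c₂ q₂ with ≈T-mul⁻ q₂
... | _ , refl , p₂ =
  typed (es-c d₁ d₂ (trans p₂ (trans p (≈M-sym (c₁ zero))))) (wk-⊕ j k (c₁ ∘ suc) c₂) q₁
weaken (app-c d d′ p) j k with weaken d j k | weaken d′ j k
... | typed d₁ c₁ q₁ | typed d₂ c₂ q₂ with ≈T-arrow⁻ q₁ | ≈T-mul⁻ q₂
... | _ , _ , refl , pM , qτ | _ , refl , p₂ =
  typed (app-c d₁ d₂ (trans p₂ (trans p (≈M-sym pM)))) (wk-⊕ j k c₁ c₂) qτ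
weaken (appt-c d d′ tM) j k with weaken d j k | weaken d′ j k
... | typed d₁ c₁ q₁ | typed d₂ c₂ q₂ with ≈T-arrow⁻ q₁
... | _ , _ , refl , pM , qτ =
  typed (appt-c d₁ (cast-type (≈T-tight⇒≡ q₂ n) d₂) (TightMT-resp-≈M (≈M-sym pM) tM)) (wk-⊕ j k c₁ c₂) qτ
weaken (abs-c {t = t} Γs ms Es ss τs ds) j k =
  typed (abs-c (ctx ∘ r) ms Es ss (ty ∘ r) (deriv ∘ r))
        (≈C-trans (sumCtx-cong (λ i → ctx≈ (r i) ∘ suc)) (wkCtx-sumCtx j k (pop ∘ Γs)))
        (mul (tabulate-≈M (λ i → arr (ctx≈ (r i) zero) (ty≈ (r i)))))
  where
  r : ∀ i → wkCtx (suc j) k (Γs i) ⊢≈[ ms i , Es i , ss i ] rename (wk (suc j) k) t ∶ τs i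
  r i = weaken (ds i) (suc j) k

-- Splitting multitype derivations of values

module ListSum {c ℓ} (M : CommutativeMonoid c ℓ) where

  open CommutativeMonoid M renaming (refl to ≈-refl; sym to ≈-sym; trans to ≈-trans)
  open import Algebra.Definitions.RawMonoid rawMonoid public using (sum)
  open import Data.List.Relation.Binary.Permutation.Setoid.Properties setoid using (foldr-commMonoid)
  open SetoidReasoning setoid

  sumᴸ : ∀ {X : Set} → (X → Carrier) → List X → Carrier
  sumᴸ g xs = foldr _∙_ ε (map g xs)

  sumᴸ-++ : ∀ {X : Set} (g : X → Carrier) xs ys → sumᴸ g (xs ++ ys) ≈ sumᴸ g xs ∙ sumᴸ g ys
  sumᴸ-++ g []       ys = ≈-sym (identityˡ _)
  sumᴸ-++ g (x ∷ xs) ys = ≈-trans (∙-congˡ (sumᴸ-++ g xs ys)) (≈-sym (assoc _ _ _))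

  sumᴸ-↭ : ∀ {X : Set} (g : X → Carrier) {xs ys} → xs ↭ ys → sumᴸ g xs ≈ sumᴸ g ys
  sumᴸ-↭ g p = foldr-commMonoid isCommutativeMonoid (↭⇒↭ₛ′ isEquivalence (↭.map⁺ g p))

  sum-lookup : ∀ {X : Set} (g : X → Carrier) xs → sum (g ∘ lookup xs) ≈ sumᴸ g xs
  sum-lookup g []       = ≈-refl
  sum-lookup g (x ∷ xs) = ∙-congˡ (sum-lookup g xs)

  sumᴸ-tabulate : ∀ {X : Set} (g : X → Carrier) {k} (f : Fin k → X) → sumᴸ g (tabulate f) ≈ sum (g ∘ f)
  sumᴸ-tabulate g {zero}  f = ≈-refl
  sumᴸ-tabulate g {suc k} f = ∙-congˡ (sumᴸ-tabulate g (f ∘ F.suc))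

  sum-lookup-split : ∀ {X : Set} (g : X → Carrier) {k} (f : Fin k → X) ys zs → tabulate f ↭ ys ++ zs →
                     sum (g ∘ lookup ys) ∙ sum (g ∘ lookup zs) ≈ sum (g ∘ f)
  sum-lookup-split g f ys zs p = begin
    sum (g ∘ lookup ys) ∙ sum (g ∘ lookup zs)  ≈⟨ ∙-cong (sum-lookup g ys) (sum-lookup g zs) ⟩
    sumᴸ g ys ∙ sumᴸ g zs                      ≈⟨ sumᴸ-++ g ys zs ⟨
    sumᴸ g (ys ++ zs)                          ≈⟨ sumᴸ-↭ g p ⟨
    sumᴸ g (tabulate f)                        ≈⟨ sumᴸ-tabulate g f ⟩
    sum (g ∘ f)                                ∎

module ℤSum = ListSum +-0-commutativeMonoid
module CtxSum = ListSum contexts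

sumℤ≡sum : ∀ {k} (f : Fin k → ℤ) → sumℤ f ≡ ℤSum.sum f
sumℤ≡sum {zero}  f = refl
sumℤ≡sum {suc k} f = Eq.cong (f F.zero +ℤ_) (sumℤ≡sum (f ∘ F.suc))

sumCtx≡sum : ∀ {k} (f : Fin k → Ctx) → sumCtx f ≡ CtxSum.sum f
sumCtx≡sum {zero}  f = refl
sumCtx≡sum {suc k} f = Eq.cong (f F.zero ⊕_) (sumCtx≡sum (f ∘ F.suc))

Pointwise⇒≈M : ∀ {P Q} → Pointwise _≈T_ P Q → P ≈M Q
Pointwise⇒≈M []      = []
Pointwise⇒≈M (p ∷ q) = p ∷ Pointwise⇒≈M q

Pointwise-↭ : ∀ {P N Q} → Pointwise _≈T_ P N → N ↭ Q → Σ MTy λ P′ → P ↭ P′ × Pointwise _≈T_ P′ Q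
Pointwise-↭ pw Perm.refl = _ , Perm.refl , pw
Pointwise-↭ (p ∷ pw) (Perm.prep _ r) with Pointwise-↭ pw r
... | _ , r′ , pw′ = _ , Perm.prep _ r′ , p ∷ pw′
Pointwise-↭ (p ∷ q ∷ pw) (Perm.swap _ _ r) with Pointwise-↭ pw r
... | _ , r′ , pw′ = _ , Perm.swap _ _ r′ , q ∷ p ∷ pw′
Pointwise-↭ pw (Perm.trans r₁ r₂) with Pointwise-↭ pw r₁
... | _ , r₁′ , pw₁ with Pointwise-↭ pw₁ r₂
... | _ , r₂′ , pw₂ = _ , Perm.trans r₁′ r₂′ , pw₂

≈M⇒↭-Pointwise : ∀ {M N} → M ≈M N → Σ MTy λ P → M ↭ P × Pointwise _≈T_ P N
≈M⇒↭-Pointwise []           = [] , Perm.refl , []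
≈M⇒↭-Pointwise (p ∷ q) with ≈M⇒↭-Pointwise q
... | _ , r , pw = _ , Perm.prep _ r , p ∷ pw
≈M⇒↭-Pointwise (swap σ τ M) = _ , Perm.swap σ τ Perm.refl , Pointwise.refl (≈T-refl _)
≈M⇒↭-Pointwise (trans p q) with ≈M⇒↭-Pointwise p | ≈M⇒↭-Pointwise q
... | _ , r₁ , pw₁ | _ , r₂ , pw₂ with Pointwise-↭ pw₁ r₂
... | _ , r₁′ , pw₁′ = _ , Perm.trans r₁ r₁′ , Pointwise.transitive ≈T-trans pw₁′ pw₂

Pointwise-map-++⁻ : ∀ {X : Set} (f : X → Ty) xs A {B} → Pointwise _≈T_ (map f xs) (A ++ B) →
  Σ (List X) λ ys → Σ (List X) λ zs →
    (xs ≡ ys ++ zs) × Pointwise _≈T_ (map f ys) A × Pointwise _≈T_ (map f zs) B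
Pointwise-map-++⁻ f xs       []      pw       = [] , xs , refl , [] , pw
Pointwise-map-++⁻ f (x ∷ xs) (σ ∷ A) (p ∷ pw) with Pointwise-map-++⁻ f xs A pw
... | ys , zs , refl , pw₁ , pw₂ = x ∷ ys , zs , refl , p ∷ pw₁ , pw₂

record AbsPremise (t : Tm) : Set where
  constructor premise
  field
    {pctx}     : Ctx
    {pm pe ps} : ℤ
    {pty}      : Ty
    pderiv     : pctx ⊢[ pm , pe , ps ] t ∶ pty
open AbsPremise

arrowOf : ∀ {t} → AbsPremise t → Ty
arrowOf p = pctx p zero ⇒ pty p

record MTyping (w : Tm) : Set where
  constructor mtyping
  field
    {vctx}     : Ctx
    {vm ve vs} : ℤ
    {vmty}     : MTy
    vderiv     : vctx ⊢[ vm , ve , vs ] w ∶ mul vmty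
open MTyping

-- Each of var-c and abs-c contributes one e by itself; the rest, ve₀,
-- is what splits additively along a splitting of the multitype.
ve₀ : ∀ {w} → MTyping w → ℤ
ve₀ D = ve D -ℤ 1ℤ

abs-mtyping : ∀ {k t} → (Fin k → AbsPremise t) → MTyping (lam t)
abs-mtyping f = mtyping (abs-c (pctx ∘ f) (pm ∘ f) (pe ∘ f) (ps ∘ f) (pty ∘ f) (pderiv ∘ f))

record Split {w} (D : MTyping w) (A B : MTy) : Set where
  constructor split
  field
    left right : MTyping w
    left-mty   : vmty left ≈M A
    right-mty  : vmty right ≈M B
    ctx-⊕      : (vctx left ⊕ vctx right) ≈C vctx D
    m-+        : vm left +ℤ vm right ≡ vm D
    e-+        : ve₀ left +ℤ ve₀ right ≡ ve₀ D
    s-+        : vs left +ℤ vs right ≡ vs D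

sumℤ-split : ∀ {X : Set} (g : X → ℤ) {k} (f : Fin k → X) ys zs → tabulate f ↭ ys ++ zs →
             sumℤ (g ∘ lookup ys) +ℤ sumℤ (g ∘ lookup zs) ≡ sumℤ (g ∘ f)
sumℤ-split g f ys zs p = begin
  sumℤ (g ∘ lookup ys) +ℤ sumℤ (g ∘ lookup zs)
    ≡⟨ Eq.cong₂ _+ℤ_ (sumℤ≡sum (g ∘ lookup ys)) (sumℤ≡sum (g ∘ lookup zs)) ⟩
  ℤSum.sum (g ∘ lookup ys) +ℤ ℤSum.sum (g ∘ lookup zs)
    ≡⟨ ℤSum.sum-lookup-split g f ys zs p ⟩
  ℤSum.sum (g ∘ f)
    ≡⟨ sumℤ≡sum (g ∘ f) ⟨
  sumℤ (g ∘ f) ∎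
  where open Eq.≡-Reasoning

sumCtx-split : ∀ {X : Set} (g : X → Ctx) {k} (f : Fin k → X) ys zs → tabulate f ↭ ys ++ zs →
               (sumCtx (g ∘ lookup ys) ⊕ sumCtx (g ∘ lookup zs)) ≈C sumCtx (g ∘ f)
sumCtx-split g f ys zs p = begin
  sumCtx (g ∘ lookup ys) ⊕ sumCtx (g ∘ lookup zs)
    ≡⟨ Eq.cong₂ _⊕_ (sumCtx≡sum (g ∘ lookup ys)) (sumCtx≡sum (g ∘ lookup zs)) ⟩
  CtxSum.sum (g ∘ lookup ys) ⊕ CtxSum.sum (g ∘ lookup zs)
    ≈⟨ CtxSum.sum-lookup-split g f ys zs p ⟩
  CtxSum.sum (g ∘ f)
    ≡⟨ sumCtx≡sum (g ∘ f) ⟨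
  sumCtx (g ∘ f) ∎
  where open SetoidReasoning ctx-setoid

1+x-1≡x : ∀ x → (1ℤ +ℤ x) -ℤ 1ℤ ≡ x
1+x-1≡x = solve-∀

split-abs : ∀ {k t} (f : Fin k → AbsPremise t) A B → tabulate (arrowOf ∘ f) ≈M (A ++ B) →
            Split (abs-mtyping f) A B
split-abs f A B p with ≈M⇒↭-Pointwise (trans (≈M-reflexive (map-tabulate f arrowOf)) p)
... | _ , r , pw with ↭.↭-map-inv arrowOf r
... | _ , refl , r′ with Pointwise-map-++⁻ arrowOf _ A pw
... | ys , zs , refl , pw₁ , pw₂ =
  split (abs-mtyping (lookup ys)) (abs-mtyping (lookup zs))
        (mty-of ys pw₁) (mty-of zs pw₂)
        (sumCtx-split (pop ∘ pctx) f ys zs r′)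
        (sumℤ-split pm f ys zs r′)
        (begin
          ve₀ (abs-mtyping (lookup ys)) +ℤ ve₀ (abs-mtyping (lookup zs))
            ≡⟨ Eq.cong₂ _+ℤ_ (1+x-1≡x (sumℤ (pe ∘ lookup ys))) (1+x-1≡x (sumℤ (pe ∘ lookup zs))) ⟩
          sumℤ (pe ∘ lookup ys) +ℤ sumℤ (pe ∘ lookup zs)
            ≡⟨ sumℤ-split pe f ys zs r′ ⟩
          sumℤ (pe ∘ f)
            ≡⟨ 1+x-1≡x (sumℤ (pe ∘ f)) ⟨
          ve₀ (abs-mtyping f) ∎)
        (sumℤ-split ps f ys zs r′)
  where
  open Eq.≡-Reasoning
  mty-of : ∀ xs {C} → Pointwise _≈T_ (map arrowOf xs) C → tabulate (arrowOf ∘ lookup xs) ≈M C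
  mty-of xs pw = trans (≈M-reflexive (Eq.trans (Eq.sym (map-tabulate (lookup xs) arrowOf))
                                              (Eq.cong (map arrowOf) (tabulate-lookup xs))))
                       (Pointwise⇒≈M pw)

split-value : ∀ {w} → Value w → (D : MTyping w) → ∀ A B → vmty D ≈M (A ++ B) → Split D A B
split-value (var x) (mtyping (var-c .x M)) A B p =
  split (mtyping (var-c x A)) (mtyping (var-c x B)) (≈M-refl A) (≈M-refl B)
        (≈C-trans (single-⊕ x A B) (single-cong x (≈M-sym p))) refl refl refl
split-value (lam t) (mtyping (abs-c Γs ms Es ss τs ds)) A B p = split-abs (premise ∘ ds) A B p

record SplitFamily {w} (D : MTyping w) {k} (Ms : Fin k → MTy) : Set where
  constructor splitFamily
  field
    parts     : Fin k → MTyping w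
    parts-mty : ∀ i → vmty (parts i) ≈M Ms i
    ctx-sum   : sumCtx (vctx ∘ parts) ≈C vctx D
    m-sum     : sumℤ (vm ∘ parts) ≡ vm D
    e-sum     : sumℤ (ve₀ ∘ parts) ≡ ve₀ D
    s-sum     : sumℤ (vs ∘ parts) ≡ vs D

split-family : ∀ {w} → Value w → (D : MTyping w) → ∀ {k} (Ms : Fin k → MTy) →
               vmty D ≈M concatMT Ms → SplitFamily D Ms
split-family val D {zero} Ms p = split-empty val D (≈M-[]⁻ p)
  where
  split-empty : ∀ {w} → Value w → (D : MTyping w) → vmty D ≡ [] → SplitFamily D Ms
  split-empty (var x) (mtyping (var-c .x .[])) refl =
    splitFamily (λ ()) (λ ()) (λ y → ≈M-sym (single-[] x y)) refl refl refl
  split-empty (lam t) (mtyping (abs-c {zero} Γs ms Es ss τs ds)) _ =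
    splitFamily (λ ()) (λ ()) ≈C-refl refl refl refl
split-family val D {suc k} Ms p with split-value val D (Ms F.zero) (concatMT (Ms ∘ F.suc)) p
... | split D₁ D₂ p₁ p₂ c m e s with split-family val D₂ (Ms ∘ F.suc) p₂
... | splitFamily Ds ps c′ m′ e′ s′ =
  splitFamily (D₁ V.∷ Ds) (λ { F.zero → p₁ ; (F.suc i) → ps i })
              (≈C-trans (⊕-congˡ c′) c)
              (Eq.trans (Eq.cong (vm D₁ +ℤ_) m′) m)
              (Eq.trans (Eq.cong (ve₀ D₁ +ℤ_) e′) e)
              (Eq.trans (Eq.cong (vs D₁ +ℤ_) s′) s)

mtyping-vr⁻ : ∀ {w} → Value w → (D : MTyping w) → vmty D ≡ vr ∷ [] →
  Σ ℕ λ y → (w ≡ var y) × (vctx D ≈C single y (vr ∷ [])) × (vm D ≡ 0ℤ) × (ve₀ D ≡ 0ℤ) × (vs D ≡ 0ℤ)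
mtyping-vr⁻ (var x) (mtyping (var-c .x .(vr ∷ []))) refl = x , refl , ≈C-refl , refl , refl , refl
mtyping-vr⁻ (lam t) (mtyping (abs-c {suc k} Γs ms Es ss τs ds)) ()

-- Substitution

punchIn : ℕ → ℕ → ℕ
punchIn zero    y       = suc y
punchIn (suc j) zero    = zero
punchIn (suc j) (suc y) = suc (punchIn j y)

dropCtx : ℕ → Ctx → Ctx
dropCtx j Γ = Γ ∘ punchIn j

dropCtx-cong : ∀ j {Γ Δ} → Γ ≈C Δ → dropCtx j Γ ≈C dropCtx j Δ
dropCtx-cong j p y = p (punchIn j y)

dropCtx-sumCtx : ∀ j {K} (f : Fin K → Ctx) → sumCtx (dropCtx j ∘ f) ≈C dropCtx j (sumCtx f)
dropCtx-sumCtx j {zero}  f = ≈C-refl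
dropCtx-sumCtx j {suc K} f = ⊕-congˡ (dropCtx-sumCtx j (f ∘ F.suc))

substAt : ℕ → Tm → ℕ → Tm
substAt zero    v zero    = v
substAt zero    v (suc x) = var x
substAt (suc j) v         = exts (substAt j v)

exts-cong : ∀ {σ τ : ℕ → Tm} → (∀ x → σ x ≡ τ x) → ∀ x → exts σ x ≡ exts τ x
exts-cong p zero    = refl
exts-cong p (suc x) = Eq.cong (rename suc) (p x)

subst-cong : ∀ {σ τ : ℕ → Tm} → (∀ x → σ x ≡ τ x) → ∀ t → subst σ t ≡ subst τ t
subst-cong p (var x)   = p x
subst-cong p (lam t)   = Eq.cong lam (subst-cong (exts-cong p) t)
subst-cong p (app t u) = Eq.cong₂ app (subst-cong p t) (subst-cong p u)
subst-cong p (es t u)  = Eq.cong₂ es (subst-cong (exts-cong p) t) (subst-cong p u)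

subst0≡substAt : ∀ v t → subst0 v t ≡ subst (substAt zero v) t
subst0≡substAt v t = subst-cong (λ { zero → refl ; (suc x) → refl }) t

value-rename : ∀ ρ {w} → Value w → Value (rename ρ w)
value-rename ρ (var x) = var (ρ x)
value-rename ρ (lam t) = lam _

value-substAt : ∀ {v} → Value v → ∀ j x → Value (substAt j v x)
value-substAt val zero    zero    = val
value-substAt val zero    (suc x) = var x
value-substAt val (suc j) zero    = var zero
value-substAt val (suc j) (suc x) = value-rename suc (value-substAt val j x)

data SubstVar (j : ℕ) (v : Tm) : ℕ → Set where
  hit  : SubstVar j v j
  miss : ∀ {x} x′ → substAt j v x ≡ var x′ →
         (∀ M → dropCtx j (single′ x M) ≈C single′ x′ M) → (∀ M → single′ x M j ≡ []) →
         SubstVar j v x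

substVar : ∀ j v x → SubstVar j v x
substVar zero    v zero    = hit
substVar zero    v (suc x) = miss x refl (λ M → ≈C-refl) (λ M → refl)
substVar (suc j) v zero    = miss zero refl (λ M → λ { zero → ≈M-refl M ; (suc y) → [] }) (λ M → refl)
substVar (suc j) v (suc x) with substVar j v x
... | hit               = hit
... | miss x′ eq drop z = miss (suc x′) (Eq.cong (rename suc) eq)
                               (λ M → λ { zero → [] ; (suc y) → drop M y }) z

dropCtx-single-self : ∀ j M → dropCtx j (single′ j M) ≈C ∅
dropCtx-single-self zero    M y       = []
dropCtx-single-self (suc j) M zero    = []
dropCtx-single-self (suc j) M (suc y) = dropCtx-single-self j M y

dropCtx-single-hit : ∀ j M → dropCtx j (single j M) ≈C ∅
dropCtx-single-hit j M = ≈C-trans (dropCtx-cong j (single≈single′ j M)) (dropCtx-single-self j M)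

dropCtx-single-miss : ∀ j x x′ M → dropCtx j (single′ x M) ≈C single′ x′ M →
                      dropCtx j (single x M) ≈C single x′ M
dropCtx-single-miss j x x′ M drop =
  ≈C-trans (dropCtx-cong j (single≈single′ x M)) (≈C-trans drop (≈C-sym (single≈single′ x′ M)))

+-merge : ∀ a b {c d w} → c +ℤ d ≡ w → (a +ℤ c) +ℤ (b +ℤ d) ≡ (a +ℤ b) +ℤ w
+-merge a b {c} {d} refl = ℤ-interchange a c b d

+-merge-δ : ∀ δ a b {c d w} → c +ℤ d ≡ w → ((a +ℤ c) +ℤ (b +ℤ d)) +ℤ δ ≡ ((a +ℤ b) +ℤ δ) +ℤ w
+-merge-δ δ a b {w = w} h = Eq.trans (Eq.cong (_+ℤ δ) (+-merge a b h)) (ℤ-xy∙z≈xz∙y (a +ℤ b) w δ)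

⊕-merge : ∀ A B X₁ X₂ {G₁ G₂ X} → G₁ ≈C (A ⊕ X₁) → G₂ ≈C (B ⊕ X₂) → (X₁ ⊕ X₂) ≈C X →
          (G₁ ⊕ G₂) ≈C ((A ⊕ B) ⊕ X)
⊕-merge A B X₁ X₂ c₁ c₂ c =
  ≈C-trans (⊕-cong c₁ c₂) (≈C-trans (⊕-interchange A X₁ B X₂) (⊕-congˡ c))

sumℤ-+ : ∀ {k} (f g : Fin k → ℤ) → sumℤ (λ i → f i +ℤ g i) ≡ sumℤ f +ℤ sumℤ g
sumℤ-+ {zero}  f g = refl
sumℤ-+ {suc k} f g = Eq.trans (Eq.cong (f F.zero +ℤ g F.zero +ℤ_) (sumℤ-+ (f ∘ F.suc) (g ∘ F.suc)))
                              (ℤ-interchange (f F.zero) (g F.zero) _ _)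

weaken-mtyping : ∀ {w} → MTyping w → MTyping (rename suc w)
weaken-mtyping D = mtyping (cast-type (proj₁ (proj₂ (≈T-mul⁻ (ty≈ (weaken (vderiv D) 0 1)))))
                                      (deriv (weaken (vderiv D) 0 1)))

weaken-mtyping-mty : ∀ {w} (D : MTyping w) → vmty (weaken-mtyping D) ≈M vmty D
weaken-mtyping-mty D = proj₂ (proj₂ (≈T-mul⁻ (ty≈ (weaken (vderiv D) 0 1))))

-- Under a binder the substituted value is weakened: its context gains an empty slot 0.
binder-ctx : ∀ j Γ {w G} (D : MTyping w) → G ≈C (dropCtx (suc j) Γ ⊕ vctx (weaken-mtyping D)) →
             (pop G ≈C (dropCtx j (pop Γ) ⊕ vctx D)) × (G zero ≈M Γ zero)
binder-ctx j Γ D c =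
  (λ y → trans (c (suc y)) (++-congˡ-≈M (Γ (suc (punchIn j y))) (weakened (suc y)))) ,
  trans (c zero) (trans (++-congˡ-≈M (Γ zero) (weakened zero)) (≈M-reflexive (++-identityʳ (Γ zero))))
  where
  weakened : vctx (weaken-mtyping D) ≈C wkCtx 0 1 (vctx D)
  weakened = ctx≈ (weaken (vderiv D) 0 1)

substitute-unused : ∀ {Γ m e s t σ w} → Γ ⊢[ m , e , s ] t ∶ σ →
                    Value w → (D : MTyping w) → vmty D ≈M [] →
                    (Γ ⊕ vctx D) ⊢≈[ m +ℤ vm D , e +ℤ ve₀ D , s +ℤ vs D ] t ∶ σ
substitute-unused {Γ} {m} {e} {s} d val D p with split-family val D {zero} (λ ()) p
... | splitFamily _ _ c m≡ e≡ s≡ =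
  typed (recount d (zero-right m m≡) (zero-right e e≡) (zero-right s s≡))
        (≈C-trans (≈C-sym (⊕-identityʳ Γ)) (⊕-congˡ c)) (≈T-refl _)
  where
  zero-right : ∀ x {y} → 0ℤ ≡ y → x ≡ x +ℤ y
  zero-right x refl = Eq.sym (+-identityʳ x)

x≡1+[x-1] : ∀ x → x ≡ 1ℤ +ℤ (x -ℤ 1ℤ)
x≡1+[x-1] = solve-∀

value-vl : ∀ {w} → Value w → ∅ ⊢[ 0ℤ , 0ℤ , 0ℤ ] w ∶ vl
value-vl (var x) = val-p x
value-vl (lam t) = abs-p t

substitute-var-p : ∀ j x {v} → Value v → (D : MTyping (substAt j v j)) → vmty D ≈M single x (vr ∷ []) j →
  (dropCtx j (single x (vr ∷ [])) ⊕ vctx D)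
    ⊢≈[ 0ℤ +ℤ vm D , 0ℤ +ℤ ve₀ D , 0ℤ +ℤ vs D ] substAt j v x ∶ vr
substitute-var-p j x {v} val D p with substVar j v x
... | hit with ≈M-[-]⁻ (≈M-sym (trans p (≈M-reflexive (single-self j (vr ∷ [])))))
... | _ , mty≡ , vr with mtyping-vr⁻ (value-substAt val j j) D mty≡
... | y , w≡ , c , m≡ , e≡ , s≡ =
  typed (recount (cast-term (Eq.sym w≡) (var-p y)) (zero-sum m≡) (zero-sum e≡) (zero-sum s≡))
        (≈C-trans (≈C-sym c) (≈C-sym (⊕-congʳ (dropCtx-single-hit j (vr ∷ []))))) vr
  where
  zero-sum : ∀ {y} → y ≡ 0ℤ → 0ℤ ≡ 0ℤ +ℤ y
  zero-sum refl = refl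
substitute-var-p j x {v} val D p | miss x′ eq drop z =
  ≈-conv (⊕-congʳ (≈C-sym (dropCtx-single-miss j x x′ (vr ∷ []) (drop (vr ∷ []))))) (Eq.sym eq)
    (substitute-unused (var-p x′) (value-substAt val j j) D
      (trans p (≈M-reflexive (Eq.trans (single≡single′ x (vr ∷ []) j) (z (vr ∷ []))))))

substitute-var-c : ∀ j x M {v} → Value v → (D : MTyping (substAt j v j)) → vmty D ≈M single x M j →
  (dropCtx j (single x M) ⊕ vctx D)
    ⊢≈[ 0ℤ +ℤ vm D , 1ℤ +ℤ ve₀ D , 0ℤ +ℤ vs D ] substAt j v x ∶ mul M
substitute-var-c j x M {v} val D p with substVar j v x
... | hit =
  typed (recount (vderiv D) (Eq.sym (+-identityˡ (vm D))) (x≡1+[x-1] (ve D))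
                            (Eq.sym (+-identityˡ (vs D))))
        (≈C-sym (⊕-congʳ (dropCtx-single-hit j M))) (mul (trans p (≈M-reflexive (single-self j M))))
... | miss x′ eq drop z =
  ≈-conv (⊕-congʳ (≈C-sym (dropCtx-single-miss j x x′ M (drop M)))) (Eq.sym eq)
    (substitute-unused (var-c x′ M) (value-substAt val j j) D
      (trans p (≈M-reflexive (Eq.trans (single≡single′ x M j) (z M)))))

substitution : ∀ {Γ m e s t σ} → Γ ⊢[ m , e , s ] t ∶ σ →
  ∀ j {v} → Value v → (D : MTyping (substAt j v j)) → vmty D ≈M Γ j →
  (dropCtx j Γ ⊕ vctx D) ⊢≈[ m +ℤ vm D , e +ℤ ve₀ D , s +ℤ vs D ] subst (substAt j v) t ∶ σ
substitution (var-p x) j val D p = substitute-var-p j x val D p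
substitution (val-p x) j val D p =
  substitute-unused (value-vl (value-substAt val j x)) (value-substAt val j j) D p
substitution (abs-p t) j val D p = substitute-unused (abs-p _) (value-substAt val j j) D p
substitution (var-c x M) j val D p = substitute-var-c j x M val D p
substitution (app-p {Γ = Γ₁} {Δ = Δ₁} {m₁} {e₁} {s₁} {m₂} {e₂} {s₂} d p₀ d′ q₀) j val D p
  with split-value (value-substAt val j j) D (Γ₁ j) (Δ₁ j) p
... | split D₁ D₂ p₁ p₂ c m≡ e≡ s≡ with substitution d j val D₁ p₁ | substitution d′ j val D₂ p₂
... | typed d₁ c₁ q₁ | typed d₂ c₂ q₂ =
  typed (recount (app-p d₁ (vr⊎n-resp-≈T q₁ p₀) d₂ (vl⊎n-resp-≈T q₂ q₀))
                 (+-merge m₁ m₂ m≡) (+-merge e₁ e₂ e≡) (+-merge-δ 1ℤ s₁ s₂ s≡))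
        (⊕-merge (dropCtx j Γ₁) (dropCtx j Δ₁) (vctx D₁) (vctx D₂) c₁ c₂ c) n
substitution (es-p {Γ = Γ₁} {Δ = Δ₁} {m₁} {e₁} {s₁} {m₂} {e₂} {s₂} d d′ tM) j val D p
  with split-value (value-substAt val j j) D (Γ₁ (suc j)) (Δ₁ j) p
... | split D₁ D₂ p₁ p₂ c m≡ e≡ s≡
  with substitution d (suc j) val (weaken-mtyping D₁) (trans (weaken-mtyping-mty D₁) p₁)
     | substitution d′ j val D₂ p₂
... | typed d₁ c₁ q₁ | typed d₂ c₂ q₂ with binder-ctx j Γ₁ D₁ c₁
... | c₁′ , c₁₀ =
  typed (recount (es-p d₁ (cast-type (≈T-tight⇒≡ q₂ n) d₂) (TightMT-resp-≈M (≈M-sym c₁₀) tM))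
                 (+-merge m₁ m₂ m≡) (+-merge e₁ e₂ e≡) (+-merge s₁ s₂ s≡))
        (⊕-merge (dropCtx j (pop Γ₁)) (dropCtx j Δ₁) (vctx D₁) (vctx D₂) c₁′ c₂ c) q₁
substitution (es-c {Γ = Γ₁} {Δ = Δ₁} {m₁} {e₁} {s₁} {m₂} {e₂} {s₂} d d′ eq) j val D p
  with split-value (value-substAt val j j) D (Γ₁ (suc j)) (Δ₁ j) p
... | split D₁ D₂ p₁ p₂ c m≡ e≡ s≡
  with substitution d (suc j) val (weaken-mtyping D₁) (trans (weaken-mtyping-mty D₁) p₁)
     | substitution d′ j val D₂ p₂
... | typed d₁ c₁ q₁ | typed d₂ c₂ q₂ with binder-ctx j Γ₁ D₁ c₁ | ≈T-mul⁻ q₂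
... | c₁′ , c₁₀ | _ , refl , p₂′ =
  typed (recount (es-c d₁ d₂ (trans p₂′ (trans eq (≈M-sym c₁₀))))
                 (+-merge m₁ m₂ m≡) (+-merge e₁ e₂ e≡) (+-merge s₁ s₂ s≡))
        (⊕-merge (dropCtx j (pop Γ₁)) (dropCtx j Δ₁) (vctx D₁) (vctx D₂) c₁′ c₂ c) q₁
substitution (app-c {Γ = Γ₁} {Δ = Δ₁} {m₁} {e₁} {s₁} {m₂} {e₂} {s₂} d d′ eq) j val D p
  with split-value (value-substAt val j j) D (Γ₁ j) (Δ₁ j) p
... | split D₁ D₂ p₁ p₂ c m≡ e≡ s≡ with substitution d j val D₁ p₁ | substitution d′ j val D₂ p₂
... | typed d₁ c₁ q₁ | typed d₂ c₂ q₂ with ≈T-arrow⁻ q₁ | ≈T-mul⁻ q₂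
... | _ , _ , refl , pM , qτ | _ , refl , p₂′ =
  typed (recount (app-c d₁ d₂ (trans p₂′ (trans eq (≈M-sym pM))))
                 (+-merge-δ 1ℤ m₁ m₂ m≡) (+-merge-δ (-ℤ 1ℤ) e₁ e₂ e≡) (+-merge s₁ s₂ s≡))
        (⊕-merge (dropCtx j Γ₁) (dropCtx j Δ₁) (vctx D₁) (vctx D₂) c₁ c₂ c) qτ
substitution (appt-c {Γ = Γ₁} {Δ = Δ₁} {m₁} {e₁} {s₁} {m₂} {e₂} {s₂} d d′ tM) j val D p
  with split-value (value-substAt val j j) D (Γ₁ j) (Δ₁ j) p
... | split D₁ D₂ p₁ p₂ c m≡ e≡ s≡ with substitution d j val D₁ p₁ | substitution d′ j val D₂ p₂
... | typed d₁ c₁ q₁ | typed d₂ c₂ q₂ with ≈T-arrow⁻ q₁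
... | _ , _ , refl , pM , qτ =
  typed (recount (appt-c d₁ (cast-type (≈T-tight⇒≡ q₂ n) d₂) (TightMT-resp-≈M (≈M-sym pM) tM))
                 (+-merge-δ 1ℤ m₁ m₂ m≡) (+-merge-δ (-ℤ 1ℤ) e₁ e₂ e≡) (+-merge s₁ s₂ s≡))
        (⊕-merge (dropCtx j Γ₁) (dropCtx j Δ₁) (vctx D₁) (vctx D₂) c₁ c₂ c) qτ
substitution (abs-c {t = t} Γs ms Es ss τs ds) j {v} val D p =
  typed (recount (abs-c (ctx ∘ r) (λ i → ms i +ℤ vm (parts i)) (λ i → Es i +ℤ ve₀ (parts i))
                        (λ i → ss i +ℤ vs (parts i)) (ty ∘ r) (deriv ∘ r))
                 m-eq e-eq s-eq)
        ctx-eq (mul (tabulate-≈M (λ i → arr (proj₂ (binder i)) (ty≈ (r i)))))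
  where
  F : SplitFamily D (λ i → Γs i (suc j))
  F = split-family (value-substAt val j j) D _ (trans p (≈M-reflexive (sumCtx-at (pop ∘ Γs) j)))
  open SplitFamily F

  r : ∀ i → (dropCtx (suc j) (Γs i) ⊕ vctx (weaken-mtyping (parts i)))
              ⊢≈[ ms i +ℤ vm (parts i) , Es i +ℤ ve₀ (parts i) , ss i +ℤ vs (parts i) ]
              subst (substAt (suc j) v) t ∶ τs i
  r i = substitution (ds i) (suc j) val (weaken-mtyping (parts i))
                     (trans (weaken-mtyping-mty (parts i)) (parts-mty i))

  binder : ∀ i → (pop (ctx (r i)) ≈C (dropCtx j (pop (Γs i)) ⊕ vctx (parts i)))
                 × (ctx (r i) zero ≈M Γs i zero)
  binder i = binder-ctx j (Γs i) (parts i) (ctx≈ (r i))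

  sum-merge : ∀ (f g : Fin _ → ℤ) {x} → sumℤ g ≡ x → sumℤ (λ i → f i +ℤ g i) ≡ sumℤ f +ℤ x
  sum-merge f g refl = sumℤ-+ f g

  m-eq = sum-merge ms (vm ∘ parts) m-sum
  s-eq = sum-merge ss (vs ∘ parts) s-sum
  e-eq = Eq.trans (Eq.cong (1ℤ +ℤ_) (sum-merge Es (ve₀ ∘ parts) e-sum))
                  (Eq.sym (+-assoc 1ℤ (sumℤ Es) (ve₀ D)))

  ctx-eq : sumCtx (pop ∘ ctx ∘ r) ≈C (dropCtx j (sumCtx (pop ∘ Γs)) ⊕ vctx D)
  ctx-eq = ≈C-trans (sumCtx-cong (proj₁ ∘ binder))
           (≈C-trans (sumCtx-⊕ (dropCtx j ∘ pop ∘ Γs) (vctx ∘ parts))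
                     (⊕-cong (dropCtx-sumCtx j (pop ∘ Γs)) ctx-sum))

-- Derivations of terms in list contexts

-- A derivation of L⟨u⟩ is a derivation of u inside a frame contributing the
-- counters (mL, eL, sL); `replug` fills the frame with another derivation,
-- whose context may carry extra assumptions Ξ from outside L.
record Decomposition (L : LCtx) (Γ : Ctx) (m e s : ℤ) (u : Tm) (T : Ty) : Set where
  constructor decomposition
  field
    {Γᵤ}                : Ctx
    {mᵤ eᵤ sᵤ mL eL sL} : ℤ
    derivᵤ              : Γᵤ ⊢[ mᵤ , eᵤ , sᵤ ] u ∶ T
    m≡                  : m ≡ mᵤ +ℤ mL
    e≡                  : e ≡ eᵤ +ℤ eL
    s≡                  : s ≡ sᵤ +ℤ sL
    replug              : ∀ {Ξ Γ′ m′ e′ s′ u′ T′} → Γ′ ⊢[ m′ , e′ , s′ ] u′ ∶ T′ →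
                          Γ′ ≈C (Γᵤ ⊕ wkCtx 0 (length L) Ξ) →
                          (Γ ⊕ Ξ) ⊢≈[ m′ +ℤ mL , e′ +ℤ eL , s′ +ℤ sL ] plug L u′ ∶ T′

+-assoc-≡ : ∀ a b c {x} → x ≡ a +ℤ b → x +ℤ c ≡ a +ℤ (b +ℤ c)
+-assoc-≡ a b c refl = +-assoc a b c

wkCtx-extra : ∀ k Γᵤ Ξ {Γ′} → Γ′ ≈C (Γᵤ ⊕ wkCtx 0 (suc k) Ξ) → Γ′ ≈C (Γᵤ ⊕ wkCtx 0 k (wkCtx 0 1 Ξ))
wkCtx-extra k Γᵤ Ξ c y = trans (c y) (++-congˡ-≈M (Γᵤ y) (≈M-reflexive (wkCtx-suc k Ξ y)))

extra-under-binder : ∀ Γ Ξ {G} → G ≈C (Γ ⊕ wkCtx 0 1 Ξ) → (pop G ≈C (pop Γ ⊕ Ξ)) × (G zero ≈M Γ zero)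
extra-under-binder Γ Ξ c = c ∘ suc , trans (c zero) (≈M-reflexive (++-identityʳ (Γ zero)))

decompose-under-es : ∀ {L Γ₁ Δ m₁ e₁ s₁ m₂ e₂ s₂ u T u₀} → Decomposition L Γ₁ m₁ e₁ s₁ u T →
  (∀ {G m e s t T′} → G ⊢[ m , e , s ] t ∶ T′ → G zero ≈M Γ₁ zero →
     (pop G ⊕ Δ) ⊢[ m +ℤ m₂ , e +ℤ e₂ , s +ℤ s₂ ] es t u₀ ∶ T′) →
  Decomposition (u₀ ∷ L) (pop Γ₁ ⊕ Δ) (m₁ +ℤ m₂) (e₁ +ℤ e₂) (s₁ +ℤ s₂) u T
decompose-under-es {L} {Γ₁} {Δ} {m₂ = m₂} {e₂} {s₂}
  (decomposition {Γᵤ} {mᵤ} {eᵤ} {sᵤ} {mL} {eL} {sL} dᵤ m≡ e≡ s≡ replug) es-rule =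
  decomposition {mL = mL +ℤ m₂} {eL +ℤ e₂} {sL +ℤ s₂} dᵤ
    (+-assoc-≡ mᵤ mL m₂ m≡) (+-assoc-≡ eᵤ eL e₂ e≡) (+-assoc-≡ sᵤ sL s₂ s≡) replug′
  where
  replug′ : ∀ {Ξ Γ′ m′ e′ s′ u′ T′} → Γ′ ⊢[ m′ , e′ , s′ ] u′ ∶ T′ →
            Γ′ ≈C (Γᵤ ⊕ wkCtx 0 (suc (length L)) Ξ) →
            ((pop Γ₁ ⊕ Δ) ⊕ Ξ) ⊢≈[ m′ +ℤ (mL +ℤ m₂) , e′ +ℤ (eL +ℤ e₂) , s′ +ℤ (sL +ℤ s₂) ]
              plug (_ ∷ L) u′ ∶ T′
  replug′ {Ξ} {m′ = m′} {e′} {s′} d′ c with replug d′ (wkCtx-extra (length L) Γᵤ Ξ c)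
  ... | typed d″ c″ q″ with extra-under-binder Γ₁ Ξ c″
  ... | c″₊ , c″₀ =
    typed (recount (es-rule d″ c″₀) (+-assoc m′ mL m₂) (+-assoc e′ eL e₂) (+-assoc s′ sL s₂))
          (≈C-trans (⊕-congʳ c″₊) (⊕-xy∙z≈xz∙y (pop Γ₁) Ξ Δ)) q″

decompose : ∀ L {Γ m e s u T} → Γ ⊢[ m , e , s ] plug L u ∶ T → Decomposition L Γ m e s u T
decompose [] {m = m} {e} {s} d =
  decomposition d (Eq.sym (+-identityʳ m)) (Eq.sym (+-identityʳ e)) (Eq.sym (+-identityʳ s))
    λ d′ c → typed (recount d′ (Eq.sym (+-identityʳ _)) (Eq.sym (+-identityʳ _))
                                  (Eq.sym (+-identityʳ _)))
                   c (≈T-refl _)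
decompose (u₀ ∷ L) (es-p d₁ d₂ tM) =
  decompose-under-es (decompose L d₁) λ d c₀ → es-p d d₂ (TightMT-resp-≈M (≈M-sym c₀) tM)
decompose (u₀ ∷ L) (es-c d₁ d₂ p) =
  decompose-under-es (decompose L d₁) λ d c₀ → es-c d d₂ (trans p (≈M-sym c₀))

-- Subject reduction

abs-not-vr⊎n : ∀ {Γ m e s t T} → Γ ⊢[ m , e , s ] lam t ∶ T → ¬ (T ≡ vr ⊎ T ≡ n)
abs-not-vr⊎n (abs-p t)                 (inj₁ ())
abs-not-vr⊎n (abs-p t)                 (inj₂ ())
abs-not-vr⊎n (abs-c Γs ms Es ss τs ds) (inj₁ ())
abs-not-vr⊎n (abs-c Γs ms Es ss τs ds) (inj₂ ())

value-not-n : ∀ {Γ m e s w} → Value w → ¬ (Γ ⊢[ m , e , s ] w ∶ n)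
value-not-n (var x) ()
value-not-n (lam t) ()

abs-arrow⁻ : ∀ {Γ m e s t T M τ} → Γ ⊢[ m , e , s ] lam t ∶ T → T ≡ mul ((M ⇒ τ) ∷ []) →
  Σ Ctx λ Γ₀ → Σ ℤ λ m₀ → Σ ℤ λ e₀ → Σ ℤ λ s₀ → (Γ₀ ⊢[ m₀ , e₀ , s₀ ] t ∶ τ) × (Γ₀ zero ≡ M) ×
    (Γ ≈C pop Γ₀) × (m ≡ m₀) × (e ≡ 1ℤ +ℤ e₀) × (s ≡ s₀)
abs-arrow⁻ (abs-c {suc zero} Γs ms Es ss τs ds) refl =
  Γs F.zero , ms F.zero , Es F.zero , ss F.zero , ds F.zero , refl , ⊕-identityʳ _ ,
  +-identityʳ _ , Eq.cong (1ℤ +ℤ_) (+-identityʳ (Es F.zero)) , +-identityʳ _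

mutual
  ne-has-type-n : ∀ {Γ m e s t σ} → Γ ⊢[ m , e , s ] t ∶ σ → TightCtx Γ → NE t → σ ≡ n
  ne-has-type-n (app-p d p d′ q) tΓ _ = refl
  ne-has-type-n (app-c d d′ _)  tΓ (appVR vr′ _) = ⊥-elim (vr-not-arrow d (TightCtx-⊕⁻ˡ tΓ) vr′ refl)
  ne-has-type-n (app-c d d′ _)  tΓ (appNE ne′ _) with ne-has-type-n d (TightCtx-⊕⁻ˡ tΓ) ne′
  ... | ()
  ne-has-type-n (appt-c d d′ _) tΓ (appVR vr′ _) = ⊥-elim (vr-not-arrow d (TightCtx-⊕⁻ˡ tΓ) vr′ refl)
  ne-has-type-n (appt-c d d′ _) tΓ (appNE ne′ _) with ne-has-type-n d (TightCtx-⊕⁻ˡ tΓ) ne′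
  ... | ()
  ne-has-type-n (es-p d d′ tM)  tΓ (es ne₁ _) = ne-has-type-n d (TightCtx-unpop tM (TightCtx-⊕⁻ˡ tΓ)) ne₁
  ne-has-type-n (es-c d d′ _)   tΓ (es _ ne₂) with ne-has-type-n d′ (TightCtx-⊕⁻ʳ tΓ) ne₂
  ... | ()

  vr-not-arrow : ∀ {Γ m e s t σ} → Γ ⊢[ m , e , s ] t ∶ σ → TightCtx Γ → VR t →
                 ∀ {M τ} → ¬ (σ ≡ mul ((M ⇒ τ) ∷ []))
  vr-not-arrow (var-c x M) tΓ _ refl with Eq.subst TightMT (single-self x M) (tΓ x)
  ... | () ∷ _
  vr-not-arrow (es-p d d′ tM) tΓ (es vr′ _) = vr-not-arrow d (TightCtx-unpop tM (TightCtx-⊕⁻ˡ tΓ)) vr′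
  vr-not-arrow (es-c d d′ _)  tΓ (es _ ne′) eq with ne-has-type-n d′ (TightCtx-⊕⁻ʳ tΓ) ne′
  ... | ()

normal-head-not-arrow : ∀ {Γ m e s u M τ} → NE u ⊎ VR u → TightCtx Γ →
                        ¬ (Γ ⊢[ m , e , s ] u ∶ mul ((M ⇒ τ) ∷ []))
normal-head-not-arrow (inj₁ ne′) tΓ d with ne-has-type-n d tΓ ne′
... | ()
normal-head-not-arrow (inj₂ vr′) tΓ d = vr-not-arrow d tΓ vr′ refl

CounterSpec-+ʳ : ∀ {k m e m′ e′} → CounterSpec k m e m′ e′ →
                 ∀ a b → CounterSpec k (m +ℤ a) (e +ℤ b) (m′ +ℤ a) (e′ +ℤ b)
CounterSpec-+ʳ {m-step} {m} (refl , refl) a b = ℤ-xy∙z≈xz∙y m (-ℤ 1ℤ) a , refl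
CounterSpec-+ʳ {e-step} {e = e} (refl , refl) a b = ℤ-xy∙z≈xz∙y e (-ℤ 1ℤ) b , refl

CounterSpec-+ˡ : ∀ {k m e m′ e′} → CounterSpec k m e m′ e′ →
                 ∀ a b → CounterSpec k (a +ℤ m) (b +ℤ e) (a +ℤ m′) (b +ℤ e′)
CounterSpec-+ˡ {m-step} {m} (refl , refl) a b = Eq.sym (+-assoc a m (-ℤ 1ℤ)) , refl
CounterSpec-+ˡ {e-step} {e = e} (refl , refl) a b = Eq.sym (+-assoc b e (-ℤ 1ℤ)) , refl

Reduct : Ctx → ℤ → ℤ → ℤ → Ty → Kind → Tm → Set
Reduct Γ m e s σ k t′ = Σ ℤ λ m′ → Σ ℤ λ e′ → (Γ ⊢≈[ m′ , e′ , s ] t′ ∶ σ) × CounterSpec k m e m′ e′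

dB-m : ∀ mₜ mᵤ mL → (mₜ +ℤ mᵤ) +ℤ mL ≡ (((mₜ +ℤ mL) +ℤ mᵤ) +ℤ 1ℤ) -ℤ 1ℤ
dB-m = solve-∀

dB-e : ∀ eₜ eᵤ eL → (eₜ +ℤ eᵤ) +ℤ eL ≡ (((1ℤ +ℤ eₜ) +ℤ eL) +ℤ eᵤ) -ℤ 1ℤ
dB-e = solve-∀

dB-s : ∀ sₜ sᵤ sL → (sₜ +ℤ sᵤ) +ℤ sL ≡ (sₜ +ℤ sL) +ℤ sᵤ
dB-s = solve-∀

contract-dB : ∀ {Γ m e s σ} L {t u} → Γ ⊢[ m , e , s ] app (plug L (lam t)) u ∶ σ →
              Reduct Γ m e s σ m-step (plug L (es t (shift (length L) u)))
contract-dB L (app-p d₁ p _ _) = ⊥-elim (abs-not-vr⊎n (derivᵤ (decompose L d₁)) p)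
  where open Decomposition
contract-dB L (app-c {m' = mᵤ} {e' = eᵤ} {s' = sᵤ} d₁ d₂ p)
  with decompose L d₁
... | decomposition {mL = mL} {eL} {sL} dλ refl refl refl replug with abs-arrow⁻ dλ refl
... | _ , mₜ , eₜ , sₜ , dt , refl , cλ , refl , refl , refl with weaken d₂ 0 (length L)
... | typed du cu qu with ≈T-mul⁻ qu
... | _ , refl , pu with replug (es-c dt du (trans pu p)) (⊕-cong (≈C-sym cλ) cu)
... | typed d′ c′ q′ =
  _ , _ , typed (recount d′ refl refl (dB-s sₜ sᵤ sL)) c′ q′ , dB-m mₜ mᵤ mL , dB-e eₜ eᵤ eL
contract-dB L (appt-c {m' = mᵤ} {e' = eᵤ} {s' = sᵤ} d₁ d₂ tM)
  with decompose L d₁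
... | decomposition {mL = mL} {eL} {sL} dλ refl refl refl replug with abs-arrow⁻ dλ refl
... | _ , mₜ , eₜ , sₜ , dt , refl , cλ , refl , refl , refl with weaken d₂ 0 (length L)
... | typed du cu qu with replug (es-p dt (cast-type (≈T-tight⇒≡ qu n) du) tM) (⊕-cong (≈C-sym cλ) cu)
... | typed d′ c′ q′ =
  _ , _ , typed (recount d′ refl refl (dB-s sₜ sᵤ sL)) c′ q′ , dB-m mₜ mᵤ mL , dB-e eₜ eᵤ eL

sv-e : ∀ eₜ eᵥ eL → (eₜ +ℤ (eᵥ -ℤ 1ℤ)) +ℤ eL ≡ (eₜ +ℤ (eᵥ +ℤ eL)) -ℤ 1ℤ
sv-e = solve-∀

contract-sv : ∀ {Γ m e s σ} L {t v} → Value v → Γ ⊢[ m , e , s ] es t (plug L v) ∶ σ →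
              Reduct Γ m e s σ e-step (plug L (subst0 v (rename (ext (length L +_)) t)))
contract-sv L val (es-p d₁ d₂ tM) =
  ⊥-elim (value-not-n val (derivᵤ (decompose L d₂)))
  where open Decomposition
contract-sv L {t} {v} val (es-c {Γ = Γ₁} {Δ = Δ} {m = mₜ} {e = eₜ} {s = sₜ} d₁ d₂ p)
  with decompose L d₂
... | decomposition {Γᵥ} {mᵥ} {eᵥ} {sᵥ} {mL} {eL} {sL} dv refl refl refl replug
  with weaken d₁ 1 (length L)
... | typed dt ct qt with substitution dt 0 val (mtyping dv) (trans p (≈M-sym (ct zero)))
... | typed dr cr qr
  with replug {Ξ = pop Γ₁} dr (≈C-trans cr (≈C-trans (⊕-congʳ (ct ∘ suc)) (⊕-comm _ Γᵥ)))
... | typed d′ c′ q′ =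
  _ , _ ,
  typed (cast-term (Eq.cong (plug L) (Eq.sym (subst0≡substAt v (rename (wk 1 (length L)) t))))
                   (recount d′ refl refl (+-assoc sₜ sᵥ sL)))
        (≈C-trans c′ (⊕-comm Δ (pop Γ₁))) (≈T-trans q′ (≈T-trans qr qt)) ,
  sv-e eₜ eᵥ eL , +-assoc mₜ mᵥ mL

subject-reduction : ∀ {Γ m e s t σ} → Γ ⊢[ m , e , s ] t ∶ σ → TightCtx Γ →
                    ∀ {k t′} → t ⟶[ k ] t′ → Reduct Γ m e s σ k t′
subject-reduction d _ (dB L t u)     = contract-dB L d
subject-reduction d _ (sv L t v val) = contract-sv L val d
subject-reduction (app-p {m' = m₂} {e' = e₂} d₁ p d₂ q) tΓ (appL _ st _)
  with subject-reduction d₁ (TightCtx-⊕⁻ˡ tΓ) st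
... | _ , _ , typed d₁′ c₁ q₁ , cs =
  _ , _ , typed (app-p d₁′ (vr⊎n-resp-≈T q₁ p) d₂ q) (⊕-congʳ c₁) n , CounterSpec-+ʳ cs m₂ e₂
subject-reduction (app-c {m' = m₂} {e' = e₂} d₁ d₂ p) tΓ (appL _ st _)
  with subject-reduction d₁ (TightCtx-⊕⁻ˡ tΓ) st
... | _ , _ , typed d₁′ c₁ q₁ , cs with ≈T-arrow⁻ q₁
... | _ , _ , refl , pM , qτ =
  _ , _ , typed (app-c d₁′ d₂ (trans p (≈M-sym pM))) (⊕-congʳ c₁) qτ ,
  CounterSpec-+ʳ (CounterSpec-+ʳ cs m₂ e₂) 1ℤ (-ℤ 1ℤ)
subject-reduction (appt-c {m' = m₂} {e' = e₂} d₁ d₂ tM) tΓ (appL _ st _)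
  with subject-reduction d₁ (TightCtx-⊕⁻ˡ tΓ) st
... | _ , _ , typed d₁′ c₁ q₁ , cs with ≈T-arrow⁻ q₁
... | _ , _ , refl , pM , qτ =
  _ , _ , typed (appt-c d₁′ d₂ (TightMT-resp-≈M (≈M-sym pM) tM)) (⊕-congʳ c₁) qτ ,
  CounterSpec-+ʳ (CounterSpec-+ʳ cs m₂ e₂) 1ℤ (-ℤ 1ℤ)
subject-reduction (app-p {m = m₁} {e = e₁} d₁ p d₂ q) tΓ (appR _ st)
  with subject-reduction d₂ (TightCtx-⊕⁻ʳ tΓ) st
... | _ , _ , typed d₂′ c₂ q₂ , cs =
  _ , _ , typed (app-p d₁ p d₂′ (vl⊎n-resp-≈T q₂ q)) (⊕-congˡ c₂) n , CounterSpec-+ˡ cs m₁ e₁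
subject-reduction (app-c d₁ _ _)  tΓ (appR nv _) = ⊥-elim (normal-head-not-arrow nv (TightCtx-⊕⁻ˡ tΓ) d₁)
subject-reduction (appt-c d₁ _ _) tΓ (appR nv _) = ⊥-elim (normal-head-not-arrow nv (TightCtx-⊕⁻ˡ tΓ) d₁)
subject-reduction (es-p {m = m₁} {e = e₁} d₁ d₂ tM) tΓ (esR _ st _)
  with subject-reduction d₂ (TightCtx-⊕⁻ʳ tΓ) st
... | _ , _ , typed d₂′ c₂ q₂ , cs =
  _ , _ , typed (es-p d₁ (cast-type (≈T-tight⇒≡ q₂ n) d₂′) tM) (⊕-congˡ c₂) (≈T-refl _) ,
  CounterSpec-+ˡ cs m₁ e₁
subject-reduction (es-c {m = m₁} {e = e₁} d₁ d₂ p) tΓ (esR _ st _)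
  with subject-reduction d₂ (TightCtx-⊕⁻ʳ tΓ) st
... | _ , _ , typed d₂′ c₂ q₂ , cs with ≈T-mul⁻ q₂
... | _ , refl , p₂ =
  _ , _ , typed (es-c d₁ d₂′ (trans p₂ p)) (⊕-congˡ c₂) (≈T-refl _) , CounterSpec-+ˡ cs m₁ e₁
subject-reduction (es-p {m' = m₂} {e' = e₂} d₁ d₂ tM) tΓ (esL st _)
  with subject-reduction d₁ (TightCtx-unpop tM (TightCtx-⊕⁻ˡ tΓ)) st
... | _ , _ , typed d₁′ c₁ q₁ , cs =
  _ , _ , typed (es-p d₁′ d₂ (TightMT-resp-≈M (≈M-sym (c₁ zero)) tM)) (⊕-congʳ (c₁ ∘ suc)) q₁ ,
  CounterSpec-+ʳ cs m₂ e₂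
subject-reduction (es-c _ d₂ _) tΓ (esL _ nu) with ne-has-type-n d₂ (TightCtx-⊕⁻ʳ tΓ) nu
... | ()

lemma4p7 : ∀ {Γ m e s t σ} → Γ ⊢[ m , e , s ] t ∶ σ → TightCtx Γ → TightTy σ →
    ∀ {k t'} → t ⟶[ k ] t' →
    Σ Ctx λ Γ' → Σ ℤ λ m' → Σ ℤ λ e' →
      (Γ' ⊢[ m' , e' , s ] t' ∶ σ) × (Γ' ≈C Γ) × CounterSpec k m e m' e'
lemma4p7 d tΓ tσ st with subject-reduction d tΓ st
... | m′ , e′ , typed d′ c q , cs = _ , m′ , e′ , cast-type (≈T-tight⇒≡ q tσ) d′ , c , cs
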